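{- As $n\to\infty$, $\gamma(\Theta_{n,3})\sim\alpha(\Theta_{n,3})$. As $t\to\infty$, $\beta(\Theta_{2,t})=o(\gamma(\Theta_{2,t}))$.
   Context: $\Theta_{n,t}$ is the graph consisting of two vertices $u,v$ joined by $t$ internally vertex-disjoint $u$–$v$ paths, each of length $n$. For a connected loopless graph $G$ with $p$ vertices and $q$ edges, $\alpha(G)$ is its number of acyclic orientations and $\deg v$ the degree of vertex $v$; $$\beta(G)=\prod_{v\in V(G)}(\deg v+1)\prod_{uw\in E(G)}\exp\frac{ -1}{2(\deg u+1)(\deg w+1)}.$$ Fix a spanning tree $T$ of $G$ with non-tree edges $e_1,\dots,e_k$ ($k=q-p+1$), let $C_i$ be the edge set of the unique cycle in $T+e_i$, and let $x_1,\dots,x_k$ be variables. For a monomial $m$, let $L_d(m)$ be the set of monomials of total degree $d$ dividing $m$, and $l_d(G)=|L_d(x_1^{|C_1|-2}\cdots x_k^{|C_k|-2})|$. Define $\gamma(G)=\sum_{d=0}^{p-1}l_d(G)2^{p-d-1}$. (For the graphs $\Theta_{n,3}$ and $\Theta_{2,t}$ every fundamental circuit has length $2n$, resp. $4$, for every choice of spanning tree, so $\gamma$ is well defined.) $f\sim g$ means $f/g\to1$, and $f=o(g)$ means $f/g\to0$. -}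

module Defs where

open import Data.Bool using (Bool; true; false; not; _∧_; _∨_; if_then_else_)
open import Data.Nat using (ℕ; zero; suc; _+_; _*_; _∸_; _^_; _≤_; _≡ᵇ_; _≤ᵇ_)
open import Data.Nat.Combinatorics using ()
open import Data.List using (List; []; _∷_; _++_; map; length; filter; upTo; foldr; concatMap)
open import Data.Bool.ListAction using (any; all)
open import Data.Nat.ListAction using (sum; product)
open import Data.Product using (_×_; _,_; proj₁; proj₂)
open import Data.Integer using (+_)
open import Data.Rational as ℚ using (ℚ; _/_; 0ℚ; 1ℚ; ½)
open import Relation.Binary.PropositionalEquality using (_≡_)
open import Relation.Nullary.Decidable using (⌊_⌋)

-- Finite loopless multigraphs: vertices 0 .. p-1, an ordered list of
-- edges (each an unordered pair, stored as a pair of vertex numbers).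

record Graph : Set where
  constructor mkGraph
  field
    p     : ℕ
    edges : List (ℕ × ℕ)
open Graph public

q : Graph → ℕ
q G = length (edges G)

vertices : Graph → List ℕ
vertices G = upTo (p G)

consecutive : List ℕ → List (ℕ × ℕ)
consecutive []            = []
consecutive (a ∷ [])      = []
consecutive (a ∷ b ∷ xs)  = (a , b) ∷ consecutive (b ∷ xs)

-- Θ_{n,t}: vertex u = 0, v = 1; the i-th path (i < t) is
--   0 , 2 + i(n-1) + 0 , … , 2 + i(n-1) + (n-2) , 1
-- so it has n edges and n-1 internal vertices.
thetaPath : ℕ → ℕ → List ℕ
thetaPath n i = 0 ∷ (map (λ j → 2 + i * (n ∸ 1) + j) (upTo (n ∸ 1)) ++ (1 ∷ []))

Θ : ℕ → ℕ → Graph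
Θ n t = mkGraph (2 + t * (n ∸ 1)) (concatMap (λ i → consecutive (thetaPath n i)) (upTo t))

-- Degrees (the graph is loopless, so an edge is incident to v at most once)

incident : ℕ → ℕ × ℕ → Bool
incident v (a , b) = (v ≡ᵇ a) ∨ (v ≡ᵇ b)

deg : Graph → ℕ → ℕ
deg G v = length (filter (λ e → incident v e ≡? true) (edges G))
  where
  open import Data.Bool.Properties using () renaming (_≟_ to _≡?_)

walkIn : ℕ → List (ℕ × ℕ) → ℕ → ℕ → Bool
walkIn zero    A a b = a ≡ᵇ b
walkIn (suc k) A a b = any (λ e → (proj₁ e ≡ᵇ a) ∧ walkIn k A (proj₂ e) b) A

orientEdge : Bool → ℕ × ℕ → ℕ × ℕ
orientEdge true  (a , b) = (a , b)
orientEdge false (a , b) = (b , a)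

orient : List Bool → List (ℕ × ℕ) → List (ℕ × ℕ)
orient (o ∷ os) (e ∷ es) = orientEdge o e ∷ orient os es
orient _        _        = []

-- a digraph on p vertices has a directed cycle iff some vertex lies on a
-- closed directed walk of length between 1 and p
hasDirectedCycle : ℕ → List (ℕ × ℕ) → Bool
hasDirectedCycle p A = any (λ v → any (λ k → walkIn (suc k) A v v) (upTo p)) (upTo p)

allBools : ℕ → List (List Bool)
allBools zero    = [] ∷ []
allBools (suc m) = map (true ∷_) (allBools m) ++ map (false ∷_) (allBools m)

α : Graph → ℕ
α G = length (filter (λ os → not (hasDirectedCycle (p G) (orient os (edges G))) ≡? true)
                     (allBools (q G)))
  where
  open import Data.Bool.Properties using () renaming (_≟_ to _≡?_)

-- Spanning trees, given as a selection (List Bool, one entry per edge)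

selected : List Bool → List (ℕ × ℕ) → List (ℕ × ℕ)
selected (true  ∷ s) (e ∷ es) = e ∷ selected s es
selected (false ∷ s) (e ∷ es) = selected s es
selected _           _        = []

unselected : List Bool → List (ℕ × ℕ) → List (ℕ × ℕ)
unselected (true  ∷ s) (e ∷ es) = unselected s es
unselected (false ∷ s) (e ∷ es) = e ∷ unselected s es
unselected _           es       = es

-- undirected walks use both orientations of every edge
bothWays : List (ℕ × ℕ) → List (ℕ × ℕ)
bothWays = concatMap (λ e → e ∷ (proj₂ e , proj₁ e) ∷ [])

connectedVia : ℕ → List (ℕ × ℕ) → Bool
connectedVia p E = all (λ v → any (λ k → walkIn k (bothWays E) 0 v) (upTo p)) (upTo p)

record IsSpanningTree (G : Graph) (T : List Bool) : Set where
  field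
    len       : length T ≡ q G
    size      : length (selected T (edges G)) ≡ p G ∸ 1
    connected : connectedVia (p G) (selected T (edges G)) ≡ true

-- distance in the tree: least k < p with an undirected walk of length k
-- (in a tree, this is the length of the unique path)
distVia : ℕ → List (ℕ × ℕ) → ℕ → ℕ → ℕ
distVia p E a b = go (upTo p)
  where
  go : List ℕ → ℕ
  go []       = p
  go (k ∷ ks) = if walkIn k (bothWays E) a b then k else go ks

-- |C_i| for the non-tree edges e_i = {a,b}: (tree path length from a to b) + 1
circuitLengths : (G : Graph) → List Bool → List ℕ
circuitLengths G T =
  map (λ e → suc (distVia (p G) (selected T (edges G)) (proj₁ e) (proj₂ e)))
      (unselected T (edges G))

-- l_d for the monomial x_1^{c_1-2} ⋯ x_k^{c_k-2}: number of exponent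
-- vectors (a_1,…,a_k) with 0 ≤ a_i ≤ c_i - 2 and a_1+⋯+a_k = d
ld : List ℕ → ℕ → ℕ
ld []       d = if d ≡ᵇ 0 then 1 else 0
ld (c ∷ cs) d = sum (map (λ a → if a ≤ᵇ d then ld cs (d ∸ a) else 0) (upTo (suc (c ∸ 2))))

γ : (G : Graph) → List Bool → ℕ
γ G T = sum (map (λ d → ld (circuitLengths G T) d * 2 ^ (p G ∸ d ∸ 1)) (upTo (p G)))

-- β(G) = P(G) · exp(−B(G)) with
--   P(G) = ∏_v (deg v + 1)   and   B(G) = Σ_{uw ∈ E} 1 / (2 (deg u+1)(deg w+1)).

βProd : Graph → ℕ
βProd G = product (map (λ v → suc (deg G v)) (vertices G))

βExp : Graph → ℚ
βExp G = foldr ℚ._+_ 0ℚ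
  (map (λ e → ½ ℚ.* ((+ 1 / suc (deg G (proj₁ e))) ℚ.* (+ 1 / suc (deg G (proj₂ e)))))
       (edges G))

expTerm : ℚ → ℕ → ℚ
expTerm x zero    = 1ℚ
expTerm x (suc j) = expTerm x j ℚ.* (x ℚ.* (+ 1 / suc j))

expPartial : ℚ → ℕ → ℚ
expPartial x m = foldr ℚ._+_ 0ℚ (map (expTerm x) (upTo m))

ℕtoℚ : ℕ → ℚ
ℕtoℚ n = + n / 1

{-# OPTIONS --safe #-}
-- Both α(Θ(n,3)) and γ(Θ(n,3)) lie within 6·4ⁿ of 8ⁿ.  An orientation of Θ(n,3) in which no path
-- is directed from end to end is acyclic, as a height function rising along every arc shows, so
-- α ≥ (2ⁿ − 2)³.  Every fundamental circuit of Θ(n,t), t ≥ 2, has length at least 2n: a potential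
-- that changes by one along every edge but the non-tree edge jumps by 2n − 1 across it.  With two
-- circuits that long, γ = Σ_d l_d 2^(p−1−d) falls short of 2^(p+1) = 8ⁿ only by a geometric tail.
-- On Θ(2,t) all t − 1 circuits have length 4, and taking them in pairs gives γ ≥ 11^⌊(t−1)/2⌋,
-- while β ≤ ∏ (deg v + 1) ≤ (2t + 1)²·3ᵗ and 3 < √11.
module Submission where

open import Defs
open import Function using (_∘_; id; Equivalence)
open import Data.Nat using (ℕ; zero; suc; _+_; _*_; _∸_; _^_; _≤_; _<_; z≤n; s≤s; z<s; s<s; NonZero; >-nonZero⁻¹; ⌊_/2⌋; _≤ᵇ_; _<ᵇ_; _≡ᵇ_; _≟_; ∣_-_∣)
open import Data.Nat.Properties
open import Data.Nat.DivMod using (_/_; _%_; +-distrib-/-∣ˡ; m*n/n≡m; m<n⇒m/n≡0; [m+kn]%n≡m%n; m<n⇒m%n≡m)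
open import Data.Nat.Divisibility using (n∣m*n)
open import Data.Nat.ListAction using (sum; product)
open import Data.Nat.Solver using (module +-*-Solver)
open +-*-Solver using (solve; _:+_; _:*_; _:=_; con)
open import Data.Bool using (Bool; true; false; not; T; _∧_; if_then_else_)
open import Data.Bool.Properties using (T-∧) renaming (_≟_ to _≟ᵇ_)
open import Data.Bool.ListAction using (any)
open import Data.List using (List; []; _∷_; _++_; map; length; filter; upTo; applyUpTo; concatMap; take; drop)
open import Data.List.Properties using (length-map; length-++; map-applyUpTo; applyUpTo-∷ʳ; length-applyUpTo; concatMap-cong; ++-identityʳ; length-take; length-drop; take++drop≡id)
open import Data.List.Membership.Propositional using (_∈_; find)
open import Data.List.Membership.Propositional.Properties using (∈-concatMap⁻; ∈-applyUpTo⁻; ∈-upTo⁻)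
open import Data.List.Relation.Unary.All using (All; []; _∷_; tabulate) renaming (lookup to lookupAll; map to mapAll)
open import Data.List.Relation.Unary.All.Properties using (++⁺; map⁺)
open import Data.List.Relation.Unary.Any using (here; there; satisfied)
open import Data.List.Relation.Unary.Any.Properties using (any⁻)
open import Data.Empty using (⊥-elim)
open import Data.Product using (_×_; _,_; proj₁; proj₂; ∃; ∃₂; swap)
open import Data.Sum using (_⊎_; inj₁; inj₂) renaming (swap to swap⊎)
import Data.Integer as ℤ
import Data.Integer.Properties as ℤₚ
open import Data.Rational using () renaming (_<_ to _<ℚ_; _*_ to _*ℚ_)
import Data.Rational as ℚ
import Data.Rational.Properties as ℚₚ
import Data.Nat.Coprimality as Coprime
open import Relation.Nullary using (¬_; yes; no)
open import Relation.Binary using (tri<; tri≈; tri>)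
open import Relation.Binary.PropositionalEquality

∑< : ℕ → (ℕ → ℕ) → ℕ
∑< zero    f = 0
∑< (suc n) f = f 0 + ∑< n (f ∘ suc)

syntax ∑< n (λ i → e) = ∑[ i < n ] e

sum-map-upTo : ∀ (f : ℕ → ℕ) n → sum (map f (upTo n)) ≡ ∑[ i < n ] f i
sum-map-upTo f n = trans (cong sum (map-applyUpTo id f n)) (sum-applyUpTo f n)
  where
  sum-applyUpTo : ∀ (f : ℕ → ℕ) n → sum (applyUpTo f n) ≡ ∑[ i < n ] f i
  sum-applyUpTo f zero    = refl
  sum-applyUpTo f (suc n) = cong (f 0 +_) (sum-applyUpTo (f ∘ suc) n)

∑-cong : ∀ n {f g : ℕ → ℕ} → (∀ {i} → i < n → f i ≡ g i) → ∑[ i < n ] f i ≡ ∑[ i < n ] g i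
∑-cong zero    f≡g = refl
∑-cong (suc n) f≡g = cong₂ _+_ (f≡g z<s) (∑-cong n (f≡g ∘ s<s))

∑-mono-≤ : ∀ n {f g : ℕ → ℕ} → (∀ {i} → i < n → f i ≤ g i) → ∑[ i < n ] f i ≤ ∑[ i < n ] g i
∑-mono-≤ zero    f≤g = z≤n
∑-mono-≤ (suc n) f≤g = +-mono-≤ (f≤g z<s) (∑-mono-≤ n (f≤g ∘ s<s))

∑-zero : ∀ n {f : ℕ → ℕ} → (∀ {i} → i < n → f i ≡ 0) → ∑[ i < n ] f i ≡ 0
∑-zero zero    f≡0 = refl
∑-zero (suc n) f≡0 = cong₂ _+_ (f≡0 z<s) (∑-zero n (f≡0 ∘ s<s))

∑-const : ∀ n c → ∑[ i < n ] c ≡ n * c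
∑-const zero    c = refl
∑-const (suc n) c = cong (c +_) (∑-const n c)

∑-distrib-+ : ∀ n (f g : ℕ → ℕ) → ∑[ i < n ] (f i + g i) ≡ ∑[ i < n ] f i + ∑[ i < n ] g i
∑-distrib-+ zero    f g = refl
∑-distrib-+ (suc n) f g = trans (cong (f 0 + g 0 +_) (∑-distrib-+ n (f ∘ suc) (g ∘ suc)))
                               (+-interchange (f 0) (g 0) _ _)
  where open import Algebra.Properties.CommutativeSemigroup +-commutativeSemigroup
                      using () renaming (interchange to +-interchange)

∑-*ˡ : ∀ n c (f : ℕ → ℕ) → ∑[ i < n ] (c * f i) ≡ c * ∑[ i < n ] f i
∑-*ˡ zero    c f = sym (*-zeroʳ c)
∑-*ˡ (suc n) c f = trans (cong (c * f 0 +_) (∑-*ˡ n c (f ∘ suc))) (sym (*-distribˡ-+ c (f 0) _))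

∑-swap : ∀ n m (f : ℕ → ℕ → ℕ) → ∑[ i < n ] ∑[ j < m ] f i j ≡ ∑[ j < m ] ∑[ i < n ] f i j
∑-swap zero    m f = sym (∑-zero m (λ _ → refl))
∑-swap (suc n) m f = begin
  ∑[ j < m ] f 0 j + ∑[ i < n ] ∑[ j < m ] f (suc i) j ≡⟨ cong (∑[ j < m ] f 0 j +_) (∑-swap n m (f ∘ suc)) ⟩
  ∑[ j < m ] f 0 j + ∑[ j < m ] ∑[ i < n ] f (suc i) j ≡⟨ ∑-distrib-+ m (f 0) (λ j → ∑[ i < n ] f (suc i) j) ⟨
  ∑[ j < m ] (f 0 j + ∑[ i < n ] f (suc i) j)         ∎
  where open ≡-Reasoning

∑-prefix-≤ : ∀ {m n} (f : ℕ → ℕ) → m ≤ n → ∑[ i < m ] f i ≤ ∑[ i < n ] f i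
∑-prefix-≤ {zero}          f m≤n       = z≤n
∑-prefix-≤ {suc m} {suc n} f (s≤s m≤n) = +-monoʳ-≤ (f 0) (∑-prefix-≤ (f ∘ suc) m≤n)

∑-single-≤ : ∀ n (f : ℕ → ℕ) k {c} → (∀ {i} → i < n → i ≢ k → f i ≡ 0) → f k ≤ c → ∑[ i < n ] f i ≤ c
∑-single-≤ zero    f k       others fk≤c = z≤n
∑-single-≤ (suc n) f zero    others fk≤c =
  ≤-trans (≤-reflexive (trans (cong (f 0 +_) (∑-zero n (λ i<n → others (s<s i<n) λ ())))
                              (+-identityʳ (f 0))))
          fk≤c
∑-single-≤ (suc n) f (suc k) others fk≤c =
  ≤-trans (≤-reflexive (cong (_+ ∑[ i < n ] f (suc i)) (others z<s λ ())))
          (∑-single-≤ n (f ∘ suc) k (λ i<n i≢k → others (s<s i<n) (i≢k ∘ suc-injective)) fk≤c)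

suc≤ᵇsuc : ∀ a d → (suc a ≤ᵇ suc d) ≡ (a ≤ᵇ d)
suc≤ᵇsuc zero    d = refl
suc≤ᵇsuc (suc a) d = refl

if-true : ∀ {b} {x y : ℕ} → T b → (if b then x else y) ≡ x
if-true {true} _ = refl

if-false : ∀ {b} {x y : ℕ} → ¬ T b → (if b then x else y) ≡ y
if-false {true}  ¬b = ⊥-elim (¬b _)
if-false {false} _  = refl

count : {A : Set} → (A → Bool) → List A → ℕ
count f []       = 0
count f (x ∷ xs) = if f x then suc (count f xs) else count f xs

module _ {A : Set} (f : A → Bool) where

  length-filter≡count : ∀ xs → length (filter (λ x → f x ≟ᵇ true) xs) ≡ count f xs
  length-filter≡count []       = refl
  length-filter≡count (x ∷ xs) with f x
  ... | true  = cong suc (length-filter≡count xs)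
  ... | false = length-filter≡count xs

  count-++ : ∀ xs ys → count f (xs ++ ys) ≡ count f xs + count f ys
  count-++ []       ys = refl
  count-++ (x ∷ xs) ys with f x
  ... | true  = cong suc (count-++ xs ys)
  ... | false = count-++ xs ys

  count≤length : ∀ xs → count f xs ≤ length xs
  count≤length []       = z≤n
  count≤length (x ∷ xs) with f x
  ... | true  = s≤s (count≤length xs)
  ... | false = m≤n⇒m≤1+n (count≤length xs)

  count-∈ : ∀ {x xs} → x ∈ xs → T (f x) → 1 ≤ count f xs
  count-∈ {xs = y ∷ xs} (here refl) fx with f y
  ... | true = s≤s z≤n
  count-∈ {xs = y ∷ xs} (there x∈xs) fx with f y
  ... | true  = s≤s z≤n
  ... | false = count-∈ x∈xs fx

  count≡0⇒none : ∀ xs → count f xs ≡ 0 → All (λ x → f x ≡ false) xs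
  count≡0⇒none []       _ = []
  count≡0⇒none (x ∷ xs) c≡0 with f x in fx≡
  ... | false = fx≡ ∷ count≡0⇒none xs c≡0

  count-concatMap-applyUpTo : (g : ℕ → List A) (h : ℕ → ℕ) → ∀ t →
    count f (concatMap g (applyUpTo h t)) ≡ ∑[ i < t ] count f (g (h i))
  count-concatMap-applyUpTo g h zero    = refl
  count-concatMap-applyUpTo g h (suc t) =
    trans (count-++ (g (h 0)) _) (cong (count f (g (h 0)) +_) (count-concatMap-applyUpTo g (h ∘ suc) t))

count-mono : {A : Set} (f g : A → Bool) → ∀ xs → All (λ x → T (f x) → T (g x)) xs → count f xs ≤ count g xs
count-mono f g []       []                = z≤n
count-mono f g (x ∷ xs) (fx⇒gx ∷ f⇒g) with f x | g x | fx⇒gx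
... | true  | true  | _     = s≤s (count-mono f g xs f⇒g)
... | true  | false | fx⇒gx = ⊥-elim (fx⇒gx _)
... | false | true  | _     = m≤n⇒m≤1+n (count-mono f g xs f⇒g)
... | false | false | _     = count-mono f g xs f⇒g

count-const-true : {A : Set} → ∀ (xs : List A) → count (λ _ → true) xs ≡ length xs
count-const-true []       = refl
count-const-true (x ∷ xs) = cong suc (count-const-true xs)

any⇒1≤count : {A : Set} (f : A → Bool) → ∀ xs → T (any f xs) → 1 ≤ count f xs
any⇒1≤count f xs any-f with find (any⁻ f xs any-f)
... | x , x∈xs , fx = count-∈ f x∈xs fx

count-applyUpTo : {A : Set} (f : A → Bool) (g : ℕ → A) → ∀ n → count f (applyUpTo g n) ≡ ∑[ j < n ] count f (g j ∷ [])
count-applyUpTo f g zero    = refl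
count-applyUpTo f g (suc n) with f (g 0)
... | true  = cong suc (count-applyUpTo f (g ∘ suc) n)
... | false = count-applyUpTo f (g ∘ suc) n

length-allBools : ∀ N → length (allBools N) ≡ 2 ^ N
length-allBools zero    = refl
length-allBools (suc N) = begin
  length (map (true ∷_) (allBools N) ++ map (false ∷_) (allBools N))
    ≡⟨ length-++ (map (true ∷_) (allBools N)) ⟩
  length (map (true ∷_) (allBools N)) + length (map (false ∷_) (allBools N))
    ≡⟨ cong₂ _+_ (length-map (true ∷_) (allBools N)) (length-map (false ∷_) (allBools N)) ⟩
  length (allBools N) + length (allBools N)
    ≡⟨ cong₂ _+_ (length-allBools N) (trans (length-allBools N) (sym (+-identityʳ _))) ⟩
  2 ^ suc N ∎
  where open ≡-Reasoning

allBools-length : ∀ N → All (λ os → length os ≡ N) (allBools N)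
allBools-length zero    = refl ∷ []
allBools-length (suc N) = ++⁺ (map⁺ (mapAll (cong suc) (allBools-length N))) (map⁺ (mapAll (cong suc) (allBools-length N)))

count-allBools-suc : (f : List Bool → Bool) → ∀ N →
  count f (allBools (suc N)) ≡ count (f ∘ (true ∷_)) (allBools N) + count (f ∘ (false ∷_)) (allBools N)
count-allBools-suc f N = trans (count-++ f (map (true ∷_) (allBools N)) _)
                               (cong₂ _+_ (count-map (true ∷_) (allBools N)) (count-map (false ∷_) (allBools N)))
  where
  count-map : (g : List Bool → List Bool) → ∀ xs → count f (map g xs) ≡ count (f ∘ g) xs
  count-map g []       = refl
  count-map g (x ∷ xs) with f (g x)
  ... | true  = cong suc (count-map g xs)
  ... | false = count-map g xs

count-allBools-++ : ∀ a b (f g : List Bool → Bool) →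
  count (λ os → f (take a os) ∧ g (drop a os)) (allBools (a + b)) ≡ count f (allBools a) * count g (allBools b)
count-allBools-++ zero    b f g with f []
... | true  = sym (+-identityʳ _)
... | false = count-false (allBools b)
  where
  count-false : ∀ xs → count (λ _ → false) xs ≡ 0
  count-false []       = refl
  count-false (_ ∷ xs) = count-false xs
count-allBools-++ (suc a) b f g = begin
  count (λ os → f (take (suc a) os) ∧ g (drop (suc a) os)) (allBools (suc a + b))
    ≡⟨ count-allBools-suc (λ os → f (take (suc a) os) ∧ g (drop (suc a) os)) (a + b) ⟩
  count (λ os → f (true ∷ take a os) ∧ g (drop a os)) (allBools (a + b)) +
  count (λ os → f (false ∷ take a os) ∧ g (drop a os)) (allBools (a + b))
    ≡⟨ cong₂ _+_ (count-allBools-++ a b (f ∘ (true ∷_)) g) (count-allBools-++ a b (f ∘ (false ∷_)) g) ⟩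
  count (f ∘ (true ∷_)) (allBools a) * count g (allBools b) + count (f ∘ (false ∷_)) (allBools a) * count g (allBools b)
    ≡⟨ *-distribʳ-+ (count g (allBools b)) (count (f ∘ (true ∷_)) (allBools a)) _ ⟨
  (count (f ∘ (true ∷_)) (allBools a) + count (f ∘ (false ∷_)) (allBools a)) * count g (allBools b)
    ≡⟨ cong (_* count g (allBools b)) (count-allBools-suc f a) ⟨
  count f (allBools (suc a)) * count g (allBools b) ∎
  where open ≡-Reasoning

module _ (f : ℕ × ℕ → Bool) where

  count-selected+unselected : ∀ S E → count f (selected S E) + count f (unselected S E) ≡ count f E
  count-selected+unselected []          E        = refl
  count-selected+unselected (true ∷ S)  []       = refl
  count-selected+unselected (false ∷ S) []       = refl
  count-selected+unselected (true ∷ S)  (e ∷ E) with f e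
  ... | true  = cong suc (count-selected+unselected S E)
  ... | false = count-selected+unselected S E
  count-selected+unselected (false ∷ S) (e ∷ E) with f e
  ... | true  = trans (+-suc _ _) (cong suc (count-selected+unselected S E))
  ... | false = count-selected+unselected S E

length-selected+unselected : ∀ S E → length (selected S E) + length (unselected S E) ≡ length E
length-selected+unselected S E = begin
  length (selected S E) + length (unselected S E)
    ≡⟨ cong₂ _+_ (count-const-true (selected S E)) (count-const-true (unselected S E)) ⟨
  count (λ _ → true) (selected S E) + count (λ _ → true) (unselected S E)
    ≡⟨ count-selected+unselected (λ _ → true) S E ⟩
  count (λ _ → true) E
    ≡⟨ count-const-true E ⟩
  length E ∎
  where open ≡-Reasoning

∈-unselected⁻ : ∀ S E {e} → e ∈ unselected S E → e ∈ E
∈-unselected⁻ []          E       e∈         = e∈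
∈-unselected⁻ (true ∷ S)  []      ()
∈-unselected⁻ (false ∷ S) []      ()
∈-unselected⁻ (true ∷ S)  (_ ∷ E) e∈         = there (∈-unselected⁻ S E e∈)
∈-unselected⁻ (false ∷ S) (_ ∷ E) (here e≡)  = here e≡
∈-unselected⁻ (false ∷ S) (_ ∷ E) (there e∈) = there (∈-unselected⁻ S E e∈)

length-circuitLengths : ∀ G S → IsSpanningTree G S → length (circuitLengths G S) + (p G ∸ 1) ≡ q G
length-circuitLengths G S tree = begin
  length (circuitLengths G S) + (p G ∸ 1)
    ≡⟨ cong₂ _+_ (length-map _ (unselected S (edges G))) (sym (IsSpanningTree.size tree)) ⟩
  length (unselected S (edges G)) + length (selected S (edges G))
    ≡⟨ +-comm (length (unselected S (edges G))) _ ⟩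
  length (selected S (edges G)) + length (unselected S (edges G))
    ≡⟨ length-selected+unselected S (edges G) ⟩
  q G ∎
  where open ≡-Reasoning

-- Walks and potentials

walkIn-suc : ∀ {A a b} k → T (walkIn (suc k) A a b) → ∃ λ c → (a , c) ∈ A × T (walkIn k A c b)
walkIn-suc {A} {a} k w with find (any⁻ _ A w)
... | (x , c) , xc∈A , x≡a∧w with Equivalence.to T-∧ x≡a∧w
... | x≡a , w′ = c , subst (λ x → (x , c) ∈ A) (≡ᵇ⇒≡ x a x≡a) xc∈A , w′

Rising : (ℕ → ℕ) → ℕ × ℕ → Set
Rising h (a , b) = h a < h b

walk-rises : (h : ℕ → ℕ) {A : List (ℕ × ℕ)} → All (Rising h) A →
             ∀ k {a b} → T (walkIn (suc k) A a b) → h a < h b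
walk-rises h {A} rising k {a} {b} w with walkIn-suc {A} {a} {b} k w
walk-rises h rising zero {a} {b} w | c , ac∈A , c≡b = subst (λ x → h a < h x) (≡ᵇ⇒≡ c b c≡b) (lookupAll rising ac∈A)
walk-rises h rising (suc k) w | c , ac∈A , w′ = <-trans (lookupAll rising ac∈A) (walk-rises h rising k w′)

acyclic-of-rising : (h : ℕ → ℕ) {A : List (ℕ × ℕ)} → All (Rising h) A → ∀ P → T (not (hasDirectedCycle P A))
acyclic-of-rising h rising P = ¬T⇒T-not λ cycle →
  let v , v-cycles = satisfied (any⁻ _ (upTo P) cycle)
      k , closed   = satisfied (any⁻ _ (upTo P) v-cycles)
  in <-irrefl refl (walk-rises h rising k closed)
  where
  ¬T⇒T-not : ∀ {b} → ¬ T b → T (not b)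
  ¬T⇒T-not {true}  ¬b = ¬b _
  ¬T⇒T-not {false} _  = _

Lipschitz : (ℕ → ℕ) → ℕ × ℕ → Set
Lipschitz f (a , b) = f b ≤ suc (f a)

walk-length-≥ : (f : ℕ → ℕ) {A : List (ℕ × ℕ)} → All (Lipschitz f) A →
                ∀ k {a b} → T (walkIn k A a b) → f b ≤ k + f a
walk-length-≥ f lip zero    {a} {b} w rewrite ≡ᵇ⇒≡ a b w = ≤-refl
walk-length-≥ f {A} lip (suc k) {a} {b} w with walkIn-suc {A} {a} {b} k w
... | c , ac∈A , w′ = ≤-trans (walk-length-≥ f lip k w′)
                              (≤-trans (+-monoʳ-≤ k (lookupAll lip ac∈A)) (≤-reflexive (+-suc k _)))

bothWays-Lipschitz : (f : ℕ → ℕ) → ∀ {E} → All (λ e → Lipschitz f e × Lipschitz f (swap e)) E →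
                     All (Lipschitz f) (bothWays E)
bothWays-Lipschitz f []                   = []
bothWays-Lipschitz f ((l , l′) ∷ lips) = l ∷ l′ ∷ bothWays-Lipschitz f lips

-- The search loop of distVia is local to its definition, so it is handled through its defining equations.
first-hit-≥ : ∀ {B P} (hit : ℕ → Bool) (search : List ℕ → ℕ) →
              search [] ≡ P → (∀ k ks → search (k ∷ ks) ≡ (if hit k then k else search ks)) →
              B ≤ P → (∀ k → T (hit k) → B ≤ k) → ∀ ks → B ≤ search ks
first-hit-≥ hit search search[] search∷ B≤P hit⇒≥ [] = subst (_ ≤_) (sym search[]) B≤P
first-hit-≥ hit search search[] search∷ B≤P hit⇒≥ (k ∷ ks) rewrite search∷ k ks with hit k in hit≡
... | true  = hit⇒≥ k (subst T (sym hit≡) _)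
... | false = first-hit-≥ hit search search[] search∷ B≤P hit⇒≥ ks

distVia-≥ : ∀ {B} P E a b → B ≤ P → (∀ k → T (walkIn k (bothWays E) a b) → B ≤ k) → B ≤ distVia P E a b
distVia-≥ P E a b B≤P long with upTo P | first-hit-≥ (λ k → walkIn k (bothWays E) a b) _ refl (λ _ _ → refl) B≤P long
... | ks | bound = bound ks

-- The weighted sum γ

-- Γ cs D is γ of a graph on D + 1 vertices whose fundamental circuits have lengths cs.
Γ : List ℕ → ℕ → ℕ
Γ cs D = ∑[ d < suc D ] (ld cs d * 2 ^ (D ∸ d))

γ≡Γ : ∀ G S {D} → p G ≡ suc D → γ G S ≡ Γ (circuitLengths G S) D
γ≡Γ G S pG≡ = weights (circuitLengths G S) pG≡
  where
  weights : ∀ cs {P D} → P ≡ suc D → sum (map (λ d → ld cs d * 2 ^ (P ∸ d ∸ 1)) (upTo P)) ≡ Γ cs D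
  weights cs {D = D} refl = trans (sum-map-upTo _ (suc D)) (∑-cong (suc D) λ {d} _ →
    cong (λ e → ld cs d * 2 ^ e) (trans (∸-+-assoc (suc D) d 1) (cong (suc D ∸_) (+-comm d 1))))

Γ-nil : ∀ D → Γ [] D ≡ 2 ^ D
Γ-nil D = trans (cong (2 ^ D + 0 +_) (∑-zero D λ _ → refl)) (trans (+-identityʳ _) (+-identityʳ _))

Γ-cons : ∀ c cs D → Γ (c ∷ cs) D ≡ ∑[ a < suc (c ∸ 2) ] (if a ≤ᵇ D then Γ cs (D ∸ a) else 0)
Γ-cons c cs D = begin
  ∑[ d < suc D ] (ld (c ∷ cs) d * 2 ^ (D ∸ d))
    ≡⟨ ∑-cong (suc D) (λ {d} _ → cong (_* 2 ^ (D ∸ d)) (sum-map-upTo (term d) (suc (c ∸ 2)))) ⟩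
  ∑[ d < suc D ] (∑[ a < suc (c ∸ 2) ] term d a * 2 ^ (D ∸ d))
    ≡⟨ ∑-cong (suc D) (λ {d} _ → trans (*-comm _ (2 ^ (D ∸ d))) (sym (∑-*ˡ (suc (c ∸ 2)) (2 ^ (D ∸ d)) (term d)))) ⟩
  ∑[ d < suc D ] ∑[ a < suc (c ∸ 2) ] (2 ^ (D ∸ d) * term d a)
    ≡⟨ ∑-swap (suc D) (suc (c ∸ 2)) (λ d a → 2 ^ (D ∸ d) * term d a) ⟩
  ∑[ a < suc (c ∸ 2) ] ∑[ d < suc D ] (2 ^ (D ∸ d) * term d a)
    ≡⟨ ∑-cong (suc (c ∸ 2)) (λ {a} _ → shift a D) ⟩
  ∑[ a < suc (c ∸ 2) ] (if a ≤ᵇ D then Γ cs (D ∸ a) else 0) ∎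
  where
  open ≡-Reasoning
  term : ℕ → ℕ → ℕ
  term d a = if a ≤ᵇ d then ld cs (d ∸ a) else 0
  shift : ∀ a D → ∑[ d < suc D ] (2 ^ (D ∸ d) * term d a) ≡ (if a ≤ᵇ D then Γ cs (D ∸ a) else 0)
  shift zero    D       = ∑-cong (suc D) (λ {d} _ → *-comm (2 ^ (D ∸ d)) (ld cs d))
  shift (suc a) zero    = refl
  shift (suc a) (suc D) = begin
    2 ^ suc D * 0 + ∑[ d < suc D ] (2 ^ (D ∸ d) * term (suc d) (suc a))
      ≡⟨ cong₂ _+_ (*-zeroʳ (2 ^ suc D)) (∑-cong (suc D) λ {d} _ →
           cong (λ b → 2 ^ (D ∸ d) * (if b then ld cs (d ∸ a) else 0)) (suc≤ᵇsuc a d)) ⟩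
    ∑[ d < suc D ] (2 ^ (D ∸ d) * term d a)
      ≡⟨ shift a D ⟩
    (if a ≤ᵇ D then Γ cs (D ∸ a) else 0)
      ≡⟨ cong (λ b → if b then Γ cs (D ∸ a) else 0) (suc≤ᵇsuc a D) ⟨
    (if suc a ≤ᵇ suc D then Γ cs (suc D ∸ suc a) else 0) ∎

geometric-≤ : ∀ N D → ∑[ a < N ] (if a ≤ᵇ D then 2 ^ (D ∸ a) else 0) ≤ 2 * 2 ^ D
geometric-≤ zero    D       = z≤n
geometric-≤ (suc N) zero    = s≤s (≤-trans (≤-reflexive (∑-zero N {λ _ → 0} λ _ → refl)) z≤n)
geometric-≤ (suc N) (suc D) = begin
  2 ^ suc D + ∑[ a < N ] (if suc a ≤ᵇ suc D then 2 ^ (D ∸ a) else 0)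
    ≡⟨ cong (2 ^ suc D +_) (∑-cong N λ {a} _ → cong (λ b → if b then 2 ^ (D ∸ a) else 0) (suc≤ᵇsuc a D)) ⟩
  2 ^ suc D + ∑[ a < N ] (if a ≤ᵇ D then 2 ^ (D ∸ a) else 0)
    ≤⟨ +-monoʳ-≤ (2 ^ suc D) (geometric-≤ N D) ⟩
  2 ^ suc D + 2 ^ suc D
    ≡⟨ cong (2 ^ suc D +_) (+-identityʳ _) ⟨
  2 * 2 ^ suc D ∎
  where open ≤-Reasoning

geometric : ∀ R Y → ∑[ a < suc R ] (2 ^ ((R + Y) ∸ a)) + 2 ^ Y ≡ 2 ^ suc (R + Y)
geometric zero    Y = trans (cong (_+ 2 ^ Y) (+-identityʳ (2 ^ Y))) (cong (2 ^ Y +_) (sym (+-identityʳ (2 ^ Y))))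
geometric (suc R) Y = begin
  2 ^ suc (R + Y) + ∑[ a < suc R ] (2 ^ ((R + Y) ∸ a)) + 2 ^ Y
    ≡⟨ +-assoc (2 ^ suc (R + Y)) _ _ ⟩
  2 ^ suc (R + Y) + (∑[ a < suc R ] (2 ^ ((R + Y) ∸ a)) + 2 ^ Y)
    ≡⟨ cong (2 ^ suc (R + Y) +_) (geometric R Y) ⟩
  2 ^ suc (R + Y) + 2 ^ suc (R + Y)
    ≡⟨ cong (2 ^ suc (R + Y) +_) (+-identityʳ _) ⟨
  2 ^ suc (suc R + Y) ∎
  where open ≡-Reasoning

Γ≤ : ∀ cs D → Γ cs D ≤ 2 ^ length cs * 2 ^ D
Γ≤ []       D = ≤-reflexive (trans (Γ-nil D) (sym (+-identityʳ _)))
Γ≤ (c ∷ cs) D = begin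
  Γ (c ∷ cs) D
    ≡⟨ Γ-cons c cs D ⟩
  ∑[ a < suc (c ∸ 2) ] (if a ≤ᵇ D then Γ cs (D ∸ a) else 0)
    ≤⟨ ∑-mono-≤ (suc (c ∸ 2)) (λ {a} _ → termwise a) ⟩
  ∑[ a < suc (c ∸ 2) ] (K * (if a ≤ᵇ D then 2 ^ (D ∸ a) else 0))
    ≡⟨ ∑-*ˡ (suc (c ∸ 2)) K (λ a → if a ≤ᵇ D then 2 ^ (D ∸ a) else 0) ⟩
  K * ∑[ a < suc (c ∸ 2) ] (if a ≤ᵇ D then 2 ^ (D ∸ a) else 0)
    ≤⟨ *-monoʳ-≤ K (geometric-≤ (suc (c ∸ 2)) D) ⟩
  K * (2 * 2 ^ D)
    ≡⟨ *-assoc K 2 (2 ^ D) ⟨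
  K * 2 * 2 ^ D
    ≡⟨ cong (_* 2 ^ D) (*-comm K 2) ⟩
  2 * K * 2 ^ D ∎
  where
  open ≤-Reasoning
  K = 2 ^ length cs
  termwise : ∀ a → (if a ≤ᵇ D then Γ cs (D ∸ a) else 0) ≤ K * (if a ≤ᵇ D then 2 ^ (D ∸ a) else 0)
  termwise a with a ≤ᵇ D
  ... | true  = Γ≤ cs (D ∸ a)
  ... | false = z≤n

Γ-cons-≥ : ∀ c cs r Y → r ≤ c ∸ 2 → ∑[ a < suc r ] Γ cs ((r + Y) ∸ a) ≤ Γ (c ∷ cs) (r + Y)
Γ-cons-≥ c cs r Y r≤c∸2 = begin
  ∑[ a < suc r ] Γ cs ((r + Y) ∸ a)
    ≡⟨ ∑-cong (suc r) {f = λ a → Γ cs ((r + Y) ∸ a)}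
              (λ {a} a≤r → sym (if-true {y = 0} (≤⇒≤ᵇ (≤-trans (≤-pred a≤r) (m≤m+n r Y))))) ⟩
  ∑[ a < suc r ] (if a ≤ᵇ r + Y then Γ cs ((r + Y) ∸ a) else 0)
    ≤⟨ ∑-prefix-≤ (λ a → if a ≤ᵇ r + Y then Γ cs ((r + Y) ∸ a) else 0) (s≤s r≤c∸2) ⟩
  ∑[ a < suc (c ∸ 2) ] (if a ≤ᵇ r + Y then Γ cs ((r + Y) ∸ a) else 0)
    ≡⟨ Γ-cons c cs (r + Y) ⟨
  Γ (c ∷ cs) (r + Y) ∎
  where open ≤-Reasoning

2^≤Γ : ∀ cs D → 2 ^ D ≤ Γ cs D
2^≤Γ []       D = ≤-reflexive (sym (Γ-nil D))
2^≤Γ (c ∷ cs) D = ≤-trans (≤-trans (2^≤Γ cs D) (m≤m+n _ 0)) (Γ-cons-≥ c cs 0 D z≤n)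

Γ-double : ∀ cs Y → 2 * Γ cs Y ≤ Γ cs (suc Y)
Γ-double cs Y = begin
  2 * Γ cs Y
    ≡⟨ ∑-*ˡ (suc Y) 2 (λ d → ld cs d * 2 ^ (Y ∸ d)) ⟨
  ∑[ d < suc Y ] (2 * (ld cs d * 2 ^ (Y ∸ d)))
    ≡⟨ ∑-cong (suc Y) (λ {d} d≤Y → begin-equality
         2 * (ld cs d * 2 ^ (Y ∸ d))  ≡⟨ x∙yz≈y∙xz 2 (ld cs d) (2 ^ (Y ∸ d)) ⟩
         ld cs d * 2 ^ suc (Y ∸ d)    ≡⟨ cong (λ e → ld cs d * 2 ^ e) (+-∸-assoc 1 (≤-pred d≤Y)) ⟨
         ld cs d * 2 ^ (suc Y ∸ d)    ∎) ⟩
  ∑[ d < suc Y ] (ld cs d * 2 ^ (suc Y ∸ d))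
    ≤⟨ ∑-prefix-≤ (λ d → ld cs d * 2 ^ (suc Y ∸ d)) (n≤1+n (suc Y)) ⟩
  Γ cs (suc Y) ∎
  where
  open ≤-Reasoning
  open import Algebra.Properties.CommutativeSemigroup *-commutativeSemigroup using (x∙yz≈y∙xz)

Γ-shift-≥ : ∀ cs j Y → 2 ^ j * Γ cs Y ≤ Γ cs (j + Y)
Γ-shift-≥ cs zero    Y = ≤-reflexive (+-identityʳ _)
Γ-shift-≥ cs (suc j) Y = ≤-trans (≤-reflexive (*-assoc 2 (2 ^ j) _))
                                 (≤-trans (*-monoʳ-≤ 2 (Γ-shift-≥ cs j Y)) (Γ-double cs (j + Y)))

Γ-cons-shift-≥ : ∀ c cs r Y → r ≤ c ∸ 2 → ∑[ a < suc r ] (2 ^ (r ∸ a) * Γ cs Y) ≤ Γ (c ∷ cs) (r + Y)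
Γ-cons-shift-≥ c cs r Y r≤c∸2 = ≤-trans
  (∑-mono-≤ (suc r) λ {a} a≤r → subst (λ e → 2 ^ (r ∸ a) * Γ cs Y ≤ Γ cs e) (sym (+-∸-comm Y (≤-pred a≤r)))
                                      (Γ-shift-≥ cs (r ∸ a) Y))
  (Γ-cons-≥ c cs r Y r≤c∸2)

-- 11 = 4 + 2·2 + 3·1, from the exponent pairs (a₁, a₂) of total degree 0, 1 and 2.
Γ-pair-≥ : ∀ c₁ c₂ cs Y → 4 ≤ c₁ → 4 ≤ c₂ → 11 * Γ cs Y ≤ Γ (c₁ ∷ c₂ ∷ cs) (2 + Y)
Γ-pair-≥ c₁ c₂ cs Y 4≤c₁ 4≤c₂ = begin
  11 * x
    ≡⟨ solve 1 (λ x → con 11 :* x := (con 4 :* x :+ (con 2 :* x :+ (con 1 :* x :+ con 0)))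
                                      :+ ((con 2 :* x :+ (con 1 :* x :+ con 0)) :+ ((con 1 :* x :+ con 0) :+ con 0))) refl x ⟩
  (4 * x + (2 * x + (1 * x + 0))) + ((2 * x + (1 * x + 0)) + ((1 * x + 0) + 0))
    ≤⟨ +-mono-≤ (Γ-cons-shift-≥ c₂ cs 2 Y (2≤ 4≤c₂))
                (+-mono-≤ (Γ-cons-shift-≥ c₂ cs 1 Y (≤-trans (s≤s z≤n) (2≤ 4≤c₂)))
                          (+-monoˡ-≤ 0 (Γ-cons-shift-≥ c₂ cs 0 Y z≤n))) ⟩
  Γ (c₂ ∷ cs) (2 + Y) + (Γ (c₂ ∷ cs) (1 + Y) + (Γ (c₂ ∷ cs) Y + 0))
    ≤⟨ Γ-cons-≥ c₁ (c₂ ∷ cs) 2 Y (2≤ 4≤c₁) ⟩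
  Γ (c₁ ∷ c₂ ∷ cs) (2 + Y) ∎
  where
  open ≤-Reasoning
  x = Γ cs Y
  2≤ : ∀ {c} → 4 ≤ c → 2 ≤ c ∸ 2
  2≤ = ∸-monoˡ-≤ 2

11^≤Γ : ∀ cs Y → All (4 ≤_) cs → 11 ^ ⌊ length cs /2⌋ ≤ Γ cs (⌊ length cs /2⌋ * 2 + Y)
11^≤Γ []                 Y _                 = ≤-trans (m^n>0 2 Y) (2^≤Γ [] Y)
11^≤Γ (c ∷ [])           Y _                 = ≤-trans (m^n>0 2 Y) (2^≤Γ (c ∷ []) Y)
11^≤Γ (c₁ ∷ c₂ ∷ cs) Y (4≤c₁ ∷ 4≤c₂ ∷ long) =
  ≤-trans (*-monoʳ-≤ 11 (11^≤Γ cs Y long)) (Γ-pair-≥ c₁ c₂ cs (⌊ length cs /2⌋ * 2 + Y) 4≤c₁ 4≤c₂)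

Γ-one-≥ : ∀ c R Y → R ≤ c ∸ 2 → 2 ^ suc (R + Y) ≤ Γ (c ∷ []) (R + Y) + 2 ^ Y
Γ-one-≥ c R Y R≤c∸2 = begin
  2 ^ suc (R + Y)
    ≡⟨ geometric R Y ⟨
  ∑[ a < suc R ] (2 ^ ((R + Y) ∸ a)) + 2 ^ Y
    ≡⟨ cong (_+ 2 ^ Y) (∑-cong (suc R) λ {a} _ → sym (Γ-nil ((R + Y) ∸ a))) ⟩
  ∑[ a < suc R ] Γ [] ((R + Y) ∸ a) + 2 ^ Y
    ≤⟨ +-monoˡ-≤ (2 ^ Y) (Γ-cons-≥ c [] R Y R≤c∸2) ⟩
  Γ (c ∷ []) (R + Y) + 2 ^ Y ∎
  where open ≤-Reasoning

Γ-two-≥ : ∀ c₁ c₂ R Y → R ≤ c₁ ∸ 2 → R ≤ c₂ ∸ 2 →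
          2 ^ (2 + (R + (R + Y))) ≤ Γ (c₁ ∷ c₂ ∷ []) (R + (R + Y)) + (2 ^ suc (R + Y) + 2 ^ suc (R + Y))
Γ-two-≥ c₁ c₂ R Y R≤c₁∸2 R≤c₂∸2 = begin
  2 ^ (2 + D)
    ≡⟨ cong (2 *_) (geometric R (R + Y)) ⟨
  2 * (∑[ a < suc R ] (2 ^ (D ∸ a)) + 2 ^ (R + Y))
    ≡⟨ *-distribˡ-+ 2 (∑[ a < suc R ] (2 ^ (D ∸ a))) _ ⟩
  2 * ∑[ a < suc R ] (2 ^ (D ∸ a)) + 2 ^ suc (R + Y)
    ≡⟨ cong (_+ 2 ^ suc (R + Y)) (∑-*ˡ (suc R) 2 (λ a → 2 ^ (D ∸ a))) ⟨
  ∑[ a < suc R ] (2 ^ suc (D ∸ a)) + 2 ^ suc (R + Y)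
    ≤⟨ +-monoˡ-≤ (2 ^ suc (R + Y)) (∑-mono-≤ (suc R) λ {a} a≤R → termwise a (≤-pred a≤R)) ⟩
  ∑[ a < suc R ] (Γ (c₂ ∷ []) (D ∸ a) + 2 ^ ((R + Y) ∸ a)) + 2 ^ suc (R + Y)
    ≡⟨ cong (_+ 2 ^ suc (R + Y)) (∑-distrib-+ (suc R) (λ a → Γ (c₂ ∷ []) (D ∸ a)) (λ a → 2 ^ ((R + Y) ∸ a))) ⟩
  ∑[ a < suc R ] Γ (c₂ ∷ []) (D ∸ a) + ∑[ a < suc R ] (2 ^ ((R + Y) ∸ a)) + 2 ^ suc (R + Y)
    ≤⟨ +-monoˡ-≤ (2 ^ suc (R + Y)) (+-mono-≤ (Γ-cons-≥ c₁ (c₂ ∷ []) R (R + Y) R≤c₁∸2)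
                                             (≤-trans (m≤m+n _ (2 ^ Y)) (≤-reflexive (geometric R Y)))) ⟩
  Γ (c₁ ∷ c₂ ∷ []) D + 2 ^ suc (R + Y) + 2 ^ suc (R + Y)
    ≡⟨ +-assoc (Γ (c₁ ∷ c₂ ∷ []) D) _ _ ⟩
  Γ (c₁ ∷ c₂ ∷ []) D + (2 ^ suc (R + Y) + 2 ^ suc (R + Y)) ∎
  where
  open ≤-Reasoning
  D = R + (R + Y)
  termwise : ∀ a → a ≤ R → 2 ^ suc (D ∸ a) ≤ Γ (c₂ ∷ []) (D ∸ a) + 2 ^ ((R + Y) ∸ a)
  termwise a a≤R rewrite +-∸-assoc R (≤-trans a≤R (m≤m+n R Y)) = Γ-one-≥ c₂ R ((R + Y) ∸ a) R≤c₂∸2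

pathVertex : ℕ → ℕ → ℕ → ℕ
pathVertex m i zero    = 0
pathVertex m i (suc j) = if j <ᵇ m then 2 + i * m + j else 1

pathEdge : ℕ → ℕ → ℕ → ℕ × ℕ
pathEdge m i j = pathVertex m i j , pathVertex m i (suc j)

thetaPath≡ : ∀ m i → thetaPath (suc m) i ≡ applyUpTo (pathVertex m i) (suc (suc m))
thetaPath≡ m i = cong (0 ∷_) (begin
  map (λ j → 2 + i * m + j) (upTo m) ++ (1 ∷ [])
    ≡⟨ cong (_++ (1 ∷ [])) (map-applyUpTo id (λ j → 2 + i * m + j) m) ⟩
  applyUpTo (λ j → 2 + i * m + j) m ++ (1 ∷ [])
    ≡⟨ cong₂ _++_ (applyUpTo-cong m λ j<m → sym (if-true (<⇒<ᵇ j<m)))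
                  (cong (_∷ []) (sym (if-false (<-irrefl refl ∘ <ᵇ⇒< m m)))) ⟩
  applyUpTo (pathVertex m i ∘ suc) m ++ (pathVertex m i (suc m) ∷ [])
    ≡⟨ applyUpTo-∷ʳ (pathVertex m i ∘ suc) m ⟩
  applyUpTo (pathVertex m i ∘ suc) (suc m) ∎)
  where
  open ≡-Reasoning
  applyUpTo-cong : ∀ n {f g : ℕ → ℕ} → (∀ {j} → j < n → f j ≡ g j) → applyUpTo f n ≡ applyUpTo g n
  applyUpTo-cong zero    f≡g = refl
  applyUpTo-cong (suc n) f≡g = cong₂ _∷_ (f≡g z<s) (applyUpTo-cong n (f≡g ∘ s<s))

pathEdges : ℕ → ℕ → List (ℕ × ℕ)
pathEdges m i = applyUpTo (pathEdge m i) (suc m)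

consecutive-thetaPath : ∀ m i → consecutive (thetaPath (suc m) i) ≡ pathEdges m i
consecutive-thetaPath m i = trans (cong consecutive (thetaPath≡ m i)) (consecutive-applyUpTo (pathVertex m i) (suc m))
  where
  consecutive-applyUpTo : ∀ (x : ℕ → ℕ) k → consecutive (applyUpTo x (suc k)) ≡ applyUpTo (λ j → x j , x (suc j)) k
  consecutive-applyUpTo x zero    = refl
  consecutive-applyUpTo x (suc k) = cong ((x 0 , x 1) ∷_) (consecutive-applyUpTo (x ∘ suc) k)

edges-Θ : ∀ m t → edges (Θ (suc m) t) ≡ concatMap (pathEdges m) (upTo t)
edges-Θ m t = concatMap-cong (consecutive-thetaPath m) (upTo t)

q-Θ : ∀ m t → q (Θ (suc m) t) ≡ t * suc m
q-Θ m t = begin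
  length (edges (Θ (suc m) t))
    ≡⟨ cong length (edges-Θ m t) ⟩
  length (concatMap (pathEdges m) (upTo t))
    ≡⟨ count-const-true (concatMap (pathEdges m) (upTo t)) ⟨
  count (λ _ → true) (concatMap (pathEdges m) (upTo t))
    ≡⟨ count-concatMap-applyUpTo _ (pathEdges m) id t ⟩
  ∑[ i < t ] count (λ _ → true) (pathEdges m i)
    ≡⟨ ∑-cong t (λ {i} _ → trans (count-const-true (pathEdges m i)) (length-applyUpTo (pathEdge m i) (suc m))) ⟩
  ∑[ i < t ] suc m
    ≡⟨ ∑-const t (suc m) ⟩
  t * suc m ∎
  where open ≡-Reasoning

∈-edges-Θ : ∀ m t {e} → e ∈ edges (Θ (suc m) t) → ∃₂ λ i j → i < t × j < suc m × e ≡ pathEdge m i j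
∈-edges-Θ m t e∈ with find (∈-concatMap⁻ (pathEdges m) (subst (_ ∈_) (edges-Θ m t) e∈))
... | i , i∈ , e∈path with ∈-applyUpTo⁻ (pathEdge m i) e∈path
... | j , j<n , e≡ = i , j , ∈-upTo⁻ i∈ , j<n , e≡

module _ (m : ℕ) .{{_ : NonZero m}} where

  [i*m+j]/m≡i : ∀ i {j} → j < m → (i * m + j) / m ≡ i
  [i*m+j]/m≡i i {j} j<m = begin
    (i * m + j) / m      ≡⟨ +-distrib-/-∣ˡ j (n∣m*n i) ⟩
    i * m / m + j / m    ≡⟨ cong₂ _+_ (m*n/n≡m i m) (m<n⇒m/n≡0 j<m) ⟩
    i + 0                ≡⟨ +-identityʳ i ⟩
    i                    ∎
    where open ≡-Reasoning

  [i*m+j]%m≡j : ∀ i {j} → j < m → (i * m + j) % m ≡ j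
  [i*m+j]%m≡j i {j} j<m = trans (cong (_% m) (+-comm (i * m) j)) (trans ([m+kn]%n≡m%n j i m) (m<n⇒m%n≡m j<m))

  module _ {A : Set} (atU atV : A) (along : ℕ → ℕ → A) where

    thetaPotential : ℕ → A
    thetaPotential zero                = atU
    thetaPotential (suc zero)          = atV
    thetaPotential (suc (suc r)) = along (r / m) (suc (r % m))

    thetaPotential-pathVertex : ∀ i {j} → along i 0 ≡ atU → along i (suc m) ≡ atV → j ≤ suc m →
                                thetaPotential (pathVertex m i j) ≡ along i j
    thetaPotential-pathVertex i {zero}  at0 _   _       = sym at0
    thetaPotential-pathVertex i {suc j} _   atn (s≤s j≤m) with j <ᵇ m in j<ᵇm
    ... | true  rewrite [i*m+j]/m≡i i (<ᵇ⇒< j m (subst T (sym j<ᵇm) _))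
                      | [i*m+j]%m≡j i (<ᵇ⇒< j m (subst T (sym j<ᵇm) _)) = refl
    ... | false rewrite ≤-antisym j≤m (≮⇒≥ λ j<m → subst T j<ᵇm (<⇒<ᵇ j<m)) = sym atn

-- Acyclic orientations of Θ(n,3)

trues falses : List Bool → ℕ
trues  = count id
falses = count not

mixed : List Bool → Bool
mixed []          = false
mixed (true ∷ s)  = any not s
mixed (false ∷ s) = any id s

mixed⇒trues×falses : ∀ s → T (mixed s) → 1 ≤ trues s × 1 ≤ falses s
mixed⇒trues×falses (true ∷ s)  mix = s≤s z≤n , any⇒1≤count not s mix
mixed⇒trues×falses (false ∷ s) mix = any⇒1≤count id s mix , s≤s z≤n

count-mixed : ∀ n → count mixed (allBools (suc n)) + 2 ≡ 2 ^ suc n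
count-mixed n = begin
  count mixed (allBools (suc n)) + 2
    ≡⟨ cong (_+ 2) (count-allBools-suc mixed n) ⟩
  count (any not) (allBools n) + count (any id) (allBools n) + 2
    ≡⟨ solve 2 (λ a b → a :+ b :+ con 2 := (a :+ con 1) :+ (b :+ con 1)) refl
             (count (any not) (allBools n)) (count (any id) (allBools n)) ⟩
  (count (any not) (allBools n) + 1) + (count (any id) (allBools n) + 1)
    ≡⟨ cong₂ _+_ (count-any-not n) (trans (count-any-id n) (sym (+-identityʳ _))) ⟩
  2 ^ suc n ∎
  where
  open ≡-Reasoning
  all-count : ∀ n → count (λ _ → true) (allBools n) ≡ 2 ^ n
  all-count n = trans (count-const-true (allBools n)) (length-allBools n)
  count-any-not : ∀ n → count (any not) (allBools n) + 1 ≡ 2 ^ n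
  count-any-not zero    = refl
  count-any-not (suc n) = begin
    count (any not) (allBools (suc n)) + 1
      ≡⟨ cong (_+ 1) (count-allBools-suc (any not) n) ⟩
    count (any not) (allBools n) + count (λ _ → true) (allBools n) + 1
      ≡⟨ solve 2 (λ a b → a :+ b :+ con 1 := b :+ (a :+ con 1)) refl
               (count (any not) (allBools n)) (count (λ _ → true) (allBools n)) ⟩
    count (λ _ → true) (allBools n) + (count (any not) (allBools n) + 1)
      ≡⟨ cong₂ _+_ (all-count n) (trans (count-any-not n) (sym (+-identityʳ _))) ⟩
    2 ^ suc n ∎
  count-any-id : ∀ n → count (any id) (allBools n) + 1 ≡ 2 ^ n
  count-any-id zero    = refl
  count-any-id (suc n) = begin
    count (any id) (allBools (suc n)) + 1
      ≡⟨ cong (_+ 1) (count-allBools-suc (any id) n) ⟩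
    count (λ _ → true) (allBools n) + count (any id) (allBools n) + 1
      ≡⟨ +-assoc (count (λ _ → true) (allBools n)) _ 1 ⟩
    count (λ _ → true) (allBools n) + (count (any id) (allBools n) + 1)
      ≡⟨ cong₂ _+_ (all-count n) (trans (count-any-id n) (sym (+-identityʳ _))) ⟩
    2 ^ suc n ∎

-- pathHeight u d c s j = c + u·(forward arcs before position j) + d·(backward arcs from position j on).
pathHeight : (u d c : ℕ) → List Bool → ℕ → ℕ
pathHeight u d c s           zero    = c + d * falses s
pathHeight u d c []          (suc j) = c
pathHeight u d c (true ∷ s)  (suc j) = pathHeight u d (c + u) s j
pathHeight u d c (false ∷ s) (suc j) = pathHeight u d c s j

pathHeight-end : ∀ u d c s → pathHeight u d c s (length s) ≡ c + u * trues s
pathHeight-end u d c []          = cong (c +_) (trans (*-zeroʳ d) (sym (*-zeroʳ u)))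
pathHeight-end u d c (true ∷ s)  = trans (pathHeight-end u d (c + u) s)
                                         (trans (+-assoc c u _) (cong (c +_) (sym (*-suc u (trues s)))))
pathHeight-end u d c (false ∷ s) = pathHeight-end u d c s

orient-path-rising : ∀ (h x : ℕ → ℕ) u d c s → 1 ≤ u → 1 ≤ d →
  (∀ {j} → j ≤ length s → h (x j) ≡ pathHeight u d c s j) →
  All (Rising h) (orient s (applyUpTo (λ j → x j , x (suc j)) (length s)))
orient-path-rising h x u d c []          1≤u 1≤d heights = []
orient-path-rising h x u d c (true ∷ s)  1≤u 1≤d heights =
  subst₂ _<_ (sym (heights z≤n)) (sym (heights (s≤s z≤n))) (+-monoˡ-< (d * falses s) (m<m+n c 1≤u))
  ∷ orient-path-rising h (x ∘ suc) u d (c + u) s 1≤u 1≤d (heights ∘ s≤s)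
orient-path-rising h x u d c (false ∷ s) 1≤u 1≤d heights =
  subst₂ _<_ (sym (heights (s≤s z≤n))) (trans (cong (c +_) (sym (*-suc d (falses s)))) (sym (heights z≤n)))
         (+-monoʳ-< c (m<n+m (d * falses s) 1≤d))
  ∷ orient-path-rising h (x ∘ suc) u d c s 1≤u 1≤d (heights ∘ s≤s)

module _ (m : ℕ) .{{_ : NonZero m}} (block : ℕ → List Bool) where

  private
    n = suc m

  -- The offset makes every path start and end at height n·n, since trues·falses ≤ n·n.
  blockHeight : ℕ → ℕ → ℕ
  blockHeight i = pathHeight (falses (block i)) (trues (block i)) (n * n ∸ trues (block i) * falses (block i)) (block i)

  orientationHeight : ℕ → ℕ
  orientationHeight = thetaPotential m (n * n) (n * n) blockHeight

  orient-path-rising-Θ : ∀ i → length (block i) ≡ n → T (mixed (block i)) →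
                         All (Rising orientationHeight) (orient (block i) (consecutive (thetaPath n i)))
  orient-path-rising-Θ i len mix rewrite consecutive-thetaPath m i =
    subst (λ L → All (Rising orientationHeight) (orient s (applyUpTo (pathEdge m i) L))) len
          (orient-path-rising orientationHeight (pathVertex m i) f t c s 1≤f 1≤t heights)
    where
    s = block i
    t = trues s
    f = falses s
    c = n * n ∸ t * f
    1≤t = proj₁ (mixed⇒trues×falses s mix)
    1≤f = proj₂ (mixed⇒trues×falses s mix)
    t*f≤n*n : t * f ≤ n * n
    t*f≤n*n = *-mono-≤ (≤-trans (count≤length id s) (≤-reflexive len)) (≤-trans (count≤length not s) (≤-reflexive len))
    start : c + t * f ≡ n * n
    start = m∸n+n≡m t*f≤n*n
    end : blockHeight i n ≡ n * n
    end = begin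
      pathHeight f t c s n        ≡⟨ cong (pathHeight f t c s) len ⟨
      pathHeight f t c s (length s) ≡⟨ pathHeight-end f t c s ⟩
      c + f * t                   ≡⟨ cong (c +_) (*-comm f t) ⟩
      c + t * f                   ≡⟨ start ⟩
      n * n                       ∎
      where open ≡-Reasoning
    heights : ∀ {j} → j ≤ length s → orientationHeight (pathVertex m i j) ≡ blockHeight i j
    heights j≤ = thetaPotential-pathVertex m (n * n) (n * n) blockHeight i start end (subst (_ ≤_) len j≤)

All-orient-++ : ∀ {P : ℕ × ℕ → Set} s s′ E E′ → length s ≡ length E →
                All P (orient s E) → All P (orient s′ E′) → All P (orient (s ++ s′) (E ++ E′))
All-orient-++ []      s′ []      E′ _   _          rest = rest
All-orient-++ (o ∷ s) s′ (e ∷ E) E′ len (pe ∷ ps) rest = pe ∷ All-orient-++ s s′ E E′ (suc-injective len) ps rest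

acyclic-Θ3 : ∀ m .{{_ : NonZero m}} s₀ s₁ s₂ →
  length s₀ ≡ suc m → length s₁ ≡ suc m → length s₂ ≡ suc m → T (mixed s₀) → T (mixed s₁) → T (mixed s₂) →
  T (not (hasDirectedCycle (p (Θ (suc m) 3)) (orient (s₀ ++ s₁ ++ s₂) (edges (Θ (suc m) 3)))))
acyclic-Θ3 m s₀ s₁ s₂ len₀ len₁ len₂ mix₀ mix₁ mix₂ =
  acyclic-of-rising (orientationHeight m block) {orient (s₀ ++ s₁ ++ s₂) (edges (Θ (suc m) 3))}
    (All-orient-++ s₀ (s₁ ++ s₂) (path 0) (path 1 ++ path 2 ++ []) (trans len₀ (sym (length-path 0)))
      (orient-path-rising-Θ m block 0 len₀ mix₀)
      (All-orient-++ s₁ s₂ (path 1) (path 2 ++ []) (trans len₁ (sym (length-path 1)))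
        (orient-path-rising-Θ m block 1 len₁ mix₁)
        (subst (λ E → All (Rising (orientationHeight m block)) (orient s₂ E)) (sym (++-identityʳ (path 2)))
               (orient-path-rising-Θ m block 2 len₂ mix₂))))
    (p (Θ (suc m) 3))
  where
  block : ℕ → List Bool
  block zero          = s₀
  block (suc zero)    = s₁
  block (suc (suc _)) = s₂
  path : ℕ → List (ℕ × ℕ)
  path i = consecutive (thetaPath (suc m) i)
  length-path : ∀ i → length (path i) ≡ suc m
  length-path i = trans (cong length (consecutive-thetaPath m i)) (length-applyUpTo (pathEdge m i) (suc m))

α≡count : ∀ G → α G ≡ count (λ os → not (hasDirectedCycle (p G) (orient os (edges G)))) (allBools (q G))
α≡count G = length-filter≡count (λ os → not (hasDirectedCycle (p G) (orient os (edges G)))) (allBools (q G))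

α≤2^q : ∀ G → α G ≤ 2 ^ q G
α≤2^q G = ≤-trans (≤-reflexive (α≡count G))
                  (≤-trans (count≤length _ (allBools (q G))) (≤-reflexive (length-allBools (q G))))

α-Θ3-≥ : ∀ m .{{_ : NonZero m}} → let c = count mixed (allBools (suc m)) in c * (c * c) ≤ α (Θ (suc m) 3)
α-Θ3-≥ m = begin
  c * (c * c)
    ≡⟨ cong (c *_) (count-allBools-++ n n mixed mixed) ⟨
  c * count twoMixed (allBools (n + n))
    ≡⟨ count-allBools-++ n (n + n) mixed twoMixed ⟨
  count threeMixed (allBools (n + (n + n)))
    ≤⟨ count-mono threeMixed acyclic (allBools (n + (n + n)))
                  (mapAll (λ {os} → acyclic-if-mixed {os}) (allBools-length (n + (n + n)))) ⟩
  count acyclic (allBools (n + (n + n)))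
    ≡⟨ cong (λ N → count acyclic (allBools N)) q≡ ⟨
  count acyclic (allBools (q (Θ n 3)))
    ≡⟨ α≡count (Θ n 3) ⟨
  α (Θ n 3) ∎
  where
  open ≤-Reasoning
  n = suc m
  c = count mixed (allBools n)
  twoMixed threeMixed acyclic : List Bool → Bool
  twoMixed os   = mixed (take n os) ∧ mixed (drop n os)
  threeMixed os = mixed (take n os) ∧ twoMixed (drop n os)
  acyclic os    = not (hasDirectedCycle (p (Θ n 3)) (orient os (edges (Θ n 3))))
  q≡ : q (Θ n 3) ≡ n + (n + n)
  q≡ = trans (q-Θ m 3) (cong (λ k → n + (n + k)) (+-identityʳ n))
  acyclic-if-mixed : ∀ {os} → length os ≡ n + (n + n) → T (threeMixed os) → T (acyclic os)
  acyclic-if-mixed {os} len mix with Equivalence.to T-∧ mix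
  ... | mix₀ , mix₁₂ with Equivalence.to T-∧ mix₁₂
  ... | mix₁ , mix₂ =
    subst (λ xs → T (not (hasDirectedCycle (p (Θ n 3)) (orient xs (edges (Θ n 3))))))
          (trans (cong (take n os ++_) (take++drop≡id n (drop n os))) (take++drop≡id n os))
          (acyclic-Θ3 m (take n os) (take n (drop n os)) (drop n (drop n os)) len₀ len₁ len₂ mix₀ mix₁ mix₂)
    where
    len-rest : length (drop n os) ≡ n + n
    len-rest = trans (length-drop n os) (trans (cong (_∸ n) len) (m+n∸m≡n n (n + n)))
    len₀ : length (take n os) ≡ n
    len₀ = trans (length-take n os) (m≤n⇒m⊓n≡m (≤-trans (m≤m+n n (n + n)) (≤-reflexive (sym len))))
    len₁ : length (take n (drop n os)) ≡ n
    len₁ = trans (length-take n (drop n os)) (m≤n⇒m⊓n≡m (≤-trans (m≤m+n n n) (≤-reflexive (sym len-rest))))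
    len₂ : length (drop n (drop n os)) ≡ n
    len₂ = trans (length-drop n (drop n os)) (trans (cong (_∸ n) len-rest) (m+n∸m≡n n n))

-- Fundamental circuits of Θ(n,t)

lipschitzᵇ : (ℕ → ℕ) → ℕ × ℕ → Bool
lipschitzᵇ f (a , b) = (f b ≤ᵇ suc (f a)) ∧ (f a ≤ᵇ suc (f b))

lipschitzᵇ-sound : ∀ f e → T (lipschitzᵇ f e) → Lipschitz f e × Lipschitz f (swap e)
lipschitzᵇ-sound f (a , b) lip with Equivalence.to T-∧ lip
... | fb≤ , fa≤ = ≤ᵇ⇒≤ _ _ fb≤ , ≤ᵇ⇒≤ _ _ fa≤

lipschitzᵇ-step : ∀ f e → (f (proj₂ e) ≡ suc (f (proj₁ e)) ⊎ f (proj₁ e) ≡ suc (f (proj₂ e))) → T (lipschitzᵇ f e)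
lipschitzᵇ-step f (a , b) apart = Equivalence.from T-∧ (≤⇒≤ᵇ (near apart) , ≤⇒≤ᵇ (near (swap⊎ apart)))
  where
  near : ∀ {x y} → y ≡ suc x ⊎ x ≡ suc y → y ≤ suc x
  near (inj₁ refl) = ≤-refl
  near (inj₂ refl) = m≤n⇒m≤1+n (n≤1+n _)

-- A potential that changes by one along every edge of Θ except pathEdge m i₀ j₀, across which it jumps by 2n − 1.
module Detour (m : ℕ) .{{_ : NonZero m}} (i₀ j₀ : ℕ) (j₀<n : j₀ < suc m) where

  n = suc m

  along : ℕ → ℕ → ℕ
  along i j = if i ≡ᵇ i₀ then (if j ≤ᵇ j₀ then n ∸ j else 3 * n ∸ j) else n + j

  along-other : ∀ {i} j → i ≢ i₀ → along i j ≡ n + j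
  along-other {i} j i≢i₀ = if-false (i≢i₀ ∘ ≡ᵇ⇒≡ i i₀)

  along-before : ∀ {j} → j ≤ j₀ → along i₀ j ≡ n ∸ j
  along-before j≤j₀ = trans (if-true (≡⇒≡ᵇ i₀ i₀ refl)) (if-true (≤⇒≤ᵇ j≤j₀))

  along-after : ∀ {j} → j₀ < j → along i₀ j ≡ 3 * n ∸ j
  along-after {j} j₀<j = trans (if-true (≡⇒≡ᵇ i₀ i₀ refl)) (if-false (<⇒≱ j₀<j ∘ ≤ᵇ⇒≤ j j₀))

  f : ℕ → ℕ
  f = thetaPotential m n (n + n) along

  f-pathVertex : ∀ i {j} → j ≤ n → f (pathVertex m i j) ≡ along i j
  f-pathVertex i = thetaPotential-pathVertex m n (n + n) along i start end
    where
    start : along i 0 ≡ n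
    start with i ≟ i₀
    ... | yes refl = along-before z≤n
    ... | no  i≢i₀ = trans (along-other 0 i≢i₀) (+-identityʳ n)
    end : along i n ≡ n + n
    end with i ≟ i₀
    ... | yes refl = trans (along-after j₀<n) (trans (m+n∸m≡n n (n + (n + 0))) (cong (n +_) (+-identityʳ n)))
    ... | no  i≢i₀ = along-other n i≢i₀

  lipschitz-off-detour : ∀ i {j} → j < n → (i ≢ i₀ ⊎ j ≢ j₀) → T (lipschitzᵇ f (pathEdge m i j))
  lipschitz-off-detour i {j} j<n off rewrite f-pathVertex i (<⇒≤ j<n) | f-pathVertex i {suc j} j<n with i ≟ i₀
  ... | no i≢i₀ = lipschitzᵇ-step id (along i j , along i (suc j))
                    (inj₁ (trans (along-other (suc j) i≢i₀) (trans (+-suc n j) (cong suc (sym (along-other j i≢i₀))))))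
  lipschitz-off-detour i {j} j<n (inj₁ i≢i₀) | yes i≡i₀ = ⊥-elim (i≢i₀ i≡i₀)
  lipschitz-off-detour i {j} j<n (inj₂ j≢j₀) | yes refl with <-cmp j j₀
  ... | tri< j<j₀ _ _ = lipschitzᵇ-step id (along i₀ j , along i₀ (suc j))
                          (inj₂ (trans (along-before (<⇒≤ j<j₀))
                                       (trans (+-∸-assoc 1 j<n) (cong suc (sym (along-before j<j₀))))))
  ... | tri≈ _ j≡j₀ _ = ⊥-elim (j≢j₀ j≡j₀)
  ... | tri> _ _ j₀<j = lipschitzᵇ-step id (along i₀ j , along i₀ (suc j))
                          (inj₂ (trans (along-after j₀<j) (trans (+-∸-assoc 1 (≤-trans j<n (m≤m+n n (2 * n))))
                                                               (cong suc (sym (along-after (m<n⇒m<1+n j₀<j)))))))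

  bad : ℕ × ℕ → Bool
  bad = not ∘ lipschitzᵇ f

  private
    r = n ∸ suc j₀

  f-detour-start : f (pathVertex m i₀ j₀) ≡ suc r
  f-detour-start = trans (f-pathVertex i₀ (<⇒≤ j₀<n)) (trans (along-before ≤-refl) (+-∸-assoc 1 j₀<n))

  f-detour-end : f (pathVertex m i₀ (suc j₀)) ≡ (n + n) + r
  f-detour-end = trans (f-pathVertex i₀ j₀<n)
                       (trans (along-after ≤-refl) (trans (cong (_∸ suc j₀) 3n≡) (+-∸-assoc (n + n) j₀<n)))
    where
    3n≡ : 3 * n ≡ (n + n) + n
    3n≡ = trans (cong (λ k → n + (n + k)) (+-identityʳ n)) (sym (+-assoc n n n))

  detour-bad : T (bad (pathEdge m i₀ j₀))
  detour-bad with lipschitzᵇ f (pathEdge m i₀ j₀) in lip≡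
  ... | false = _
  ... | true  with ≤-trans (+-mono-≤ 2≤n 2≤n) (+-cancelʳ-≤ r (n + n) 2 jump≤)
    where
    2≤n : 2 ≤ n
    2≤n = s≤s (>-nonZero⁻¹ m)
    jump≤ : (n + n) + r ≤ 2 + r
    jump≤ = subst₂ (λ a b → a ≤ suc b) f-detour-end f-detour-start
                   (proj₁ (lipschitzᵇ-sound f (pathEdge m i₀ j₀) (subst T (sym lip≡) _)))
  ... | s≤s (s≤s ())

  count-bad-Θ : ∀ t → count bad (edges (Θ n t)) ≤ 1
  count-bad-Θ t = begin
    count bad (edges (Θ n t))                      ≡⟨ cong (count bad) (edges-Θ m t) ⟩
    count bad (concatMap (pathEdges m) (upTo t))   ≡⟨ count-concatMap-applyUpTo bad (pathEdges m) id t ⟩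
    ∑[ i < t ] count bad (pathEdges m i)           ≤⟨ ∑-single-≤ t (count bad ∘ pathEdges m) i₀ other-path detour-path ⟩
    1                                              ∎
    where
    open ≤-Reasoning
    good-edge : ∀ {e} → T (lipschitzᵇ f e) → count bad (e ∷ []) ≡ 0
    good-edge {e} lip with lipschitzᵇ f e
    ... | true = refl
    other-path : ∀ {i} → i < t → i ≢ i₀ → count bad (pathEdges m i) ≡ 0
    other-path {i} _ i≢i₀ = trans (count-applyUpTo bad (pathEdge m i) n) (∑-zero n {λ j → count bad (pathEdge m i j ∷ [])}
                              λ {j} j<n → good-edge {pathEdge m i j} (lipschitz-off-detour i j<n (inj₁ i≢i₀)))
    detour-path : count bad (pathEdges m i₀) ≤ 1
    detour-path = ≤-trans (≤-reflexive (count-applyUpTo bad (pathEdge m i₀) n))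
      (∑-single-≤ n (λ j → count bad (pathEdge m i₀ j ∷ [])) j₀
                  (λ {j} j<n j≢j₀ → good-edge {pathEdge m i₀ j} (lipschitz-off-detour i₀ j<n (inj₂ j≢j₀)))
                  (count≤length bad (pathEdge m i₀ j₀ ∷ [])))

  walks-across-detour : ∀ {E} → All (Lipschitz f) E → ∀ k →
                        T (walkIn k E (pathVertex m i₀ j₀) (pathVertex m i₀ (suc j₀))) → n + m ≤ k
  walks-across-detour lip k w = ≤-pred (subst (_≤ suc k) (+-suc n m) (+-cancelʳ-≤ r (n + n) (suc k) (begin
    n + n + r                              ≡⟨ f-detour-end ⟨
    f (pathVertex m i₀ (suc j₀))           ≤⟨ walk-length-≥ f lip k w ⟩
    k + f (pathVertex m i₀ j₀)             ≡⟨ cong (k +_) f-detour-start ⟩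
    k + suc r                              ≡⟨ +-suc k r ⟩
    suc k + r                              ∎)))
    where open ≤-Reasoning

circuitLengths-Θ : ∀ m .{{_ : NonZero m}} t S → 2 ≤ t → All (suc m + suc m ≤_) (circuitLengths (Θ (suc m) t) S)
circuitLengths-Θ m t S 2≤t = map⁺ (tabulate long-circuit)
  where
  n = suc m
  E = edges (Θ n t)
  sel = selected S E
  long-circuit : ∀ {e} → e ∈ unselected S E → n + n ≤ suc (distVia (p (Θ n t)) sel (proj₁ e) (proj₂ e))
  long-circuit e∈ with ∈-edges-Θ m t (∈-unselected⁻ S E e∈)
  ... | i₀ , j₀ , _ , j₀<n , refl =
    ≤-trans (≤-reflexive (+-suc n m)) (s≤s (distVia-≥ (p (Θ n t)) sel _ _ n+m≤p (walks-across-detour sel-lipschitz)))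
    where
    open Detour m i₀ j₀ j₀<n using (f; bad; detour-bad; count-bad-Θ; walks-across-detour)
    n+m≤p : n + m ≤ 2 + t * m
    n+m≤p = ≤-trans (n≤1+n _) (+-monoʳ-≤ 2 (≤-trans (≤-reflexive (cong (m +_) (sym (+-identityʳ m)))) (*-monoˡ-≤ m 2≤t)))
    no-bad-selected : count bad sel ≡ 0
    no-bad-selected = n≤0⇒n≡0 (+-cancelʳ-≤ 1 (count bad sel) 0 (begin
      count bad sel + 1                              ≤⟨ +-monoʳ-≤ (count bad sel) (count-∈ bad e∈ detour-bad) ⟩
      count bad sel + count bad (unselected S E)     ≡⟨ count-selected+unselected bad S E ⟩
      count bad E                                    ≤⟨ count-bad-Θ t ⟩
      1                                              ∎))
      where open ≤-Reasoning
    sel-lipschitz : All (Lipschitz f) (bothWays sel)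
    sel-lipschitz = bothWays-Lipschitz f (mapAll (λ {e} bad≡false → lipschitzᵇ-sound f e (not≡false bad≡false))
                                                 (count≡0⇒none bad sel no-bad-selected))
      where
      not≡false : ∀ {b} → not b ≡ false → T b
      not≡false {true} _ = _

-- γ ∼ α on Θ(n,3)

n<2^n : ∀ n → n < 2 ^ n
n<2^n zero    = z<s
n<2^n (suc n) = subst (_≤ 2 ^ suc n) (+-comm (suc n) 1)
                      (+-mono-≤ (n<2^n n) (≤-trans (m^n>0 2 n) (≤-reflexive (sym (+-identityʳ _)))))

∣-∣≤-of-window : ∀ x y {w e} → x ≤ w → w ≤ x + e → y ≤ w → w ≤ y + e → ∣ x - y ∣ ≤ e
∣-∣≤-of-window zero    y       _         w≤e       y≤w       _         = ≤-trans y≤w w≤e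
∣-∣≤-of-window (suc x) zero    x≤w       _         _         w≤e       = ≤-trans x≤w w≤e
∣-∣≤-of-window (suc x) (suc y) (s≤s x≤w) (s≤s w≤x) (s≤s y≤w) (s≤s w≤y) =
  ∣-∣≤-of-window x y x≤w w≤x y≤w w≤y

module _ (m : ℕ) .{{_ : NonZero m}} where

  private
    n = suc m
    W₄ = 2 ^ (n + n)
    W₈ = 2 ^ (n + (n + n))

  γ-Θ3-window : ∀ S → IsSpanningTree (Θ n 3) S → γ (Θ n 3) S ≤ W₈ × W₈ ≤ γ (Θ n 3) S + 6 * W₄
  γ-Θ3-window S tree = subst (λ g → g ≤ W₈ × W₈ ≤ g + 6 * W₄) (sym (γ≡Γ (Θ n 3) S p≡))
                              (window (circuitLengths (Θ n 3) S) two-circuits (circuitLengths-Θ m 3 S (s≤s (s≤s z≤n))))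
    where
    D = m + (m + n)
    p≡ : p (Θ n 3) ≡ suc D
    p≡ = solve 1 (λ m → con 2 :+ con 3 :* m := con 1 :+ (m :+ (m :+ (con 1 :+ m)))) refl m
    two-circuits : length (circuitLengths (Θ n 3) S) ≡ 2
    two-circuits = +-cancelʳ-≡ (suc (3 * m)) _ 2 (trans (length-circuitLengths (Θ n 3) S tree)
      (trans (q-Θ m 3) (solve 1 (λ m → con 3 :* (con 1 :+ m) := con 2 :+ (con 1 :+ con 3 :* m)) refl m)))
    2+D≡ : 2 + D ≡ n + (n + n)
    2+D≡ = solve 1 (λ m → con 2 :+ (m :+ (m :+ (con 1 :+ m))) := (con 1 :+ m) :+ ((con 1 :+ m) :+ (con 1 :+ m))) refl m
    m≤c∸2 : ∀ {c} → n + n ≤ c → m ≤ c ∸ 2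
    m≤c∸2 n+n≤c = ≤-trans (≤-trans (m≤m+n m m) (≤-reflexive (cong (_∸ 1) (sym (+-suc m m))))) (∸-monoˡ-≤ 2 n+n≤c)
    window : ∀ cs → length cs ≡ 2 → All (n + n ≤_) cs → Γ cs D ≤ W₈ × W₈ ≤ Γ cs D + 6 * W₄
    window (c₁ ∷ c₂ ∷ []) _ (long₁ ∷ long₂ ∷ []) =
      ≤-trans (Γ≤ (c₁ ∷ c₂ ∷ []) D) (≤-reflexive (trans (sym (^-distribˡ-+-* 2 2 D)) (cong (2 ^_) 2+D≡))) ,
      (begin
        W₈                                 ≡⟨ cong (2 ^_) 2+D≡ ⟨
        2 ^ (2 + D)                        ≤⟨ Γ-two-≥ c₁ c₂ m n (m≤c∸2 long₁) (m≤c∸2 long₂) ⟩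
        Γ (c₁ ∷ c₂ ∷ []) D + (W₄ + W₄)     ≤⟨ +-monoʳ-≤ (Γ (c₁ ∷ c₂ ∷ []) D) (+-monoʳ-≤ W₄ (m≤m+n W₄ _)) ⟩
        Γ (c₁ ∷ c₂ ∷ []) D + 6 * W₄        ∎)
      where open ≤-Reasoning

  α-Θ3-window : α (Θ n 3) ≤ W₈ × W₈ ≤ α (Θ n 3) + 6 * W₄
  α-Θ3-window =
    ≤-trans (α≤2^q (Θ n 3)) (≤-reflexive (cong (2 ^_) q≡)) ,
    (begin
      W₈                                         ≡⟨ W₈≡ ⟩
      (c + 2) * ((c + 2) * (c + 2))              ≤⟨ cube-≤ c ⟩
      c * (c * c) + 6 * ((c + 2) * (c + 2))      ≤⟨ +-monoˡ-≤ _ (α-Θ3-≥ m) ⟩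
      α (Θ n 3) + 6 * ((c + 2) * (c + 2))        ≡⟨ cong (λ w → α (Θ n 3) + 6 * w) W₄≡ ⟨
      α (Θ n 3) + 6 * W₄                         ∎)
    where
    open ≤-Reasoning
    c = count mixed (allBools n)
    q≡ : q (Θ n 3) ≡ n + (n + n)
    q≡ = trans (q-Θ m 3) (cong (λ k → n + (n + k)) (+-identityʳ n))
    W₄≡ : W₄ ≡ (c + 2) * (c + 2)
    W₄≡ = trans (^-distribˡ-+-* 2 n n) (sym (cong₂ _*_ (count-mixed m) (count-mixed m)))
    W₈≡ : W₈ ≡ (c + 2) * ((c + 2) * (c + 2))
    W₈≡ = trans (^-distribˡ-+-* 2 n (n + n)) (cong₂ _*_ (sym (count-mixed m)) W₄≡)
    cube-≤ : ∀ x → (x + 2) * ((x + 2) * (x + 2)) ≤ x * (x * x) + 6 * ((x + 2) * (x + 2))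
    cube-≤ x = ≤-trans (m≤m+n _ (12 * x + 16)) (≤-reflexive (solve 1 (λ x →
      (x :+ con 2) :* ((x :+ con 2) :* (x :+ con 2)) :+ (con 12 :* x :+ con 16)
        := x :* (x :* x) :+ con 6 :* ((x :+ con 2) :* (x :+ con 2))) refl x))

γ∼α-Θ3 : (k : ℕ) → ∃ λ N → (n : ℕ) → N ≤ n → (S : List Bool) → IsSpanningTree (Θ n 3) S →
         suc k * ∣ γ (Θ n 3) S - α (Θ n 3) ∣ ≤ α (Θ n 3)
γ∼α-Θ3 k = 6 * (2 + k) , bound
  where
  bound : (n : ℕ) → 6 * (2 + k) ≤ n → (S : List Bool) → IsSpanningTree (Θ n 3) S →
          suc k * ∣ γ (Θ n 3) S - α (Θ n 3) ∣ ≤ α (Θ n 3)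
  bound zero          ()
  bound (suc zero)    (s≤s ())
  bound (suc (suc m)) N≤n S tree = ≤-trans (*-monoʳ-≤ (suc k) close) (+-cancelʳ-≤ (6 * W₄) _ _ (begin
    suc k * (6 * W₄) + 6 * W₄
      ≡⟨ solve 2 (λ k w → (con 1 :+ k) :* (con 6 :* w) :+ con 6 :* w := con 6 :* (con 2 :+ k) :* w) refl k W₄ ⟩
    6 * (2 + k) * W₄           ≤⟨ *-monoˡ-≤ W₄ (≤-trans N≤n (<⇒≤ (n<2^n n))) ⟩
    2 ^ n * W₄                 ≡⟨ ^-distribˡ-+-* 2 n (n + n) ⟨
    2 ^ (n + (n + n))          ≤⟨ proj₂ (α-Θ3-window (suc m)) ⟩
    α (Θ n 3) + 6 * W₄         ∎))
    where
    open ≤-Reasoning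
    n = suc (suc m)
    W₄ = 2 ^ (n + n)
    close : ∣ γ (Θ n 3) S - α (Θ n 3) ∣ ≤ 6 * W₄
    close = ∣-∣≤-of-window (γ (Θ n 3) S) (α (Θ n 3))
              (proj₁ (γ-Θ3-window (suc m) S tree)) (proj₂ (γ-Θ3-window (suc m) S tree))
              (proj₁ (α-Θ3-window (suc m))) (proj₂ (α-Θ3-window (suc m)))

-- β = o(γ) on Θ(2,t)

deg≤q : ∀ G v → deg G v ≤ q G
deg≤q G v = ≤-trans (≤-reflexive (length-filter≡count (incident v) (edges G))) (count≤length (incident v) (edges G))

deg-Θ2-internal : ∀ t i → deg (Θ 2 t) (2 + i) ≤ 2
deg-Θ2-internal t i = begin
  deg (Θ 2 t) (2 + i)                                    ≡⟨ length-filter≡count (incident (2 + i)) (edges (Θ 2 t)) ⟩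
  count (incident (2 + i)) (edges (Θ 2 t))               ≡⟨ cong (count (incident (2 + i))) (edges-Θ 1 t) ⟩
  count (incident (2 + i)) (concatMap (pathEdges 1) (upTo t))
    ≡⟨ count-concatMap-applyUpTo (incident (2 + i)) (pathEdges 1) id t ⟩
  ∑[ i′ < t ] count (incident (2 + i)) (pathEdges 1 i′)  ≤⟨ ∑-single-≤ t _ i other own ⟩
  2                                                      ∎
  where
  open ≤-Reasoning
  other : ∀ {i′} → i′ < t → i′ ≢ i → count (incident (2 + i)) (pathEdges 1 i′) ≡ 0
  other {i′} _ i′≢i with i ≡ᵇ i′ * 1 + 0 in i≡
  ... | false = refl
  ... | true  = ⊥-elim (i′≢i (sym (trans (≡ᵇ⇒≡ i _ (subst T (sym i≡) _)) (trans (+-identityʳ _) (*-identityʳ i′)))))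
  own : count (incident (2 + i)) (pathEdges 1 i) ≤ 2
  own with i ≡ᵇ i * 1 + 0
  ... | false = z≤n
  ... | true  = ≤-refl

product-map-applyUpTo-≤ : ∀ (f g : ℕ → ℕ) r {c} → (∀ {x} → x < r → f (g x) ≤ c) →
                          product (map f (applyUpTo g r)) ≤ c ^ r
product-map-applyUpTo-≤ f g zero    f≤c = ≤-refl
product-map-applyUpTo-≤ f g (suc r) f≤c = *-mono-≤ (f≤c z<s) (product-map-applyUpTo-≤ f (g ∘ suc) r (f≤c ∘ s<s))

βProd-Θ2-≤ : ∀ t → βProd (Θ 2 t) ≤ suc (t * 2) * (suc (t * 2) * 3 ^ (t * 1))
βProd-Θ2-≤ t = *-mono-≤ (s≤s (deg-end 0)) (*-mono-≤ (s≤s (deg-end 1))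
  (product-map-applyUpTo-≤ (suc ∘ deg (Θ 2 t)) (suc ∘ suc) (t * 1) λ {i} _ → s≤s (deg-Θ2-internal t i)))
  where
  deg-end : ∀ v → deg (Θ 2 t) v ≤ t * 2
  deg-end v = ≤-trans (deg≤q (Θ 2 t) v) (≤-reflexive (q-Θ 1 t))

⌊n/2⌋*2≤n : ∀ n → ⌊ n /2⌋ * 2 ≤ n
⌊n/2⌋*2≤n zero          = z≤n
⌊n/2⌋*2≤n (suc zero)    = z≤n
⌊n/2⌋*2≤n (suc (suc n)) = s≤s (s≤s (⌊n/2⌋*2≤n n))

n≤1+⌊n/2⌋*2 : ∀ n → n ≤ suc (⌊ n /2⌋ * 2)
n≤1+⌊n/2⌋*2 zero          = z≤n
n≤1+⌊n/2⌋*2 (suc zero)    = ≤-refl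
n≤1+⌊n/2⌋*2 (suc (suc n)) = s≤s (s≤s (n≤1+⌊n/2⌋*2 n))

γ-Θ2-≥ : ∀ u S → IsSpanningTree (Θ 2 (2 + u)) S → 11 ^ ⌊ suc u /2⌋ ≤ γ (Θ 2 (2 + u)) S
γ-Θ2-≥ u S tree = begin
  11 ^ L                              ≤⟨ subst (λ len → 11 ^ ⌊ len /2⌋ ≤ Γ cs (⌊ len /2⌋ * 2 + (D ∸ L * 2))) len≡
                                               (11^≤Γ cs (D ∸ L * 2) (circuitLengths-Θ 1 (2 + u) S (s≤s (s≤s z≤n)))) ⟩
  Γ cs (L * 2 + (D ∸ L * 2))          ≡⟨ cong (Γ cs) (m+[n∸m]≡n L*2≤D) ⟩
  Γ cs D                              ≡⟨ γ≡Γ (Θ 2 (2 + u)) S refl ⟨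
  γ (Θ 2 (2 + u)) S                   ∎
  where
  open ≤-Reasoning
  cs = circuitLengths (Θ 2 (2 + u)) S
  L = ⌊ suc u /2⌋
  D = suc ((2 + u) * 1)
  len≡ : length cs ≡ suc u
  len≡ = +-cancelʳ-≡ D (length cs) (suc u) (trans (length-circuitLengths (Θ 2 (2 + u)) S tree)
           (trans (q-Θ 1 (2 + u)) (solve 1 (λ u → (con 2 :+ u) :* con 2 := (con 1 :+ u) :+ (con 1 :+ (con 2 :+ u) :* con 1)) refl u)))
  L*2≤D : L * 2 ≤ D
  L*2≤D = ≤-trans (⌊n/2⌋*2≤n (suc u)) (s≤s (≤-trans (m≤n+m u 2) (≤-reflexive (sym (*-identityʳ (2 + u))))))

cube*9^≤3375*11^ : ∀ x → (15 + x) * ((15 + x) * (15 + x)) * 9 ^ (14 + x) ≤ 3375 * 11 ^ (14 + x)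
cube*9^≤3375*11^ zero    = *-monoʳ-≤ 3375 (^-monoˡ-≤ 14 (m≤m+n 9 2))
cube*9^≤3375*11^ (suc x) = begin
  sy * (sy * sy) * (9 * a)
    ≡⟨ solve 2 (λ s a → s :* (s :* s) :* (con 9 :* a) := con 9 :* (s :* (s :* s)) :* a) refl sy a ⟩
  9 * (sy * (sy * sy)) * a
    ≤⟨ *-monoˡ-≤ a ratio ⟩
  11 * (y * (y * y)) * a
    ≡⟨ *-assoc 11 (y * (y * y)) a ⟩
  11 * (y * (y * y) * a)
    ≤⟨ *-monoʳ-≤ 11 (cube*9^≤3375*11^ x) ⟩
  11 * (3375 * b)
    ≡⟨ x∙yz≈y∙xz 11 3375 b ⟩
  3375 * (11 * b) ∎
  where
  open ≤-Reasoning
  open import Algebra.Properties.CommutativeSemigroup *-commutativeSemigroup using (x∙yz≈y∙xz)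
  y = 15 + x
  sy = suc y
  a = 9 ^ (14 + x)
  b = 11 ^ (14 + x)
  -- (16/15)³ < 11/9
  ratio : 9 * (sy * (sy * sy)) ≤ 11 * (y * (y * y))
  ratio = ≤-trans (m≤m+n _ (2 * (x * (x * x)) + 63 * (x * x) + 513 * x + 261)) (≤-reflexive (solve 1 (λ x →
    con 9 :* ((con 16 :+ x) :* ((con 16 :+ x) :* (con 16 :+ x)))
      :+ (con 2 :* (x :* (x :* x)) :+ con 63 :* (x :* x) :+ con 513 :* x :+ con 261)
      := con 11 :* ((con 15 :+ x) :* ((con 15 :+ x) :* (con 15 :+ x)))) refl x))

quadratic*9^<11^ : ∀ K L → 14 + 3375 * K ≤ L → K * (suc L * (suc L * 9 ^ L)) < 11 ^ L
quadratic*9^<11^ K L L≥ = subst (λ z → K * (suc z * (suc z * 9 ^ z)) < 11 ^ z) (m+[n∸m]≡n 14≤L)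
                                (from-14 (L ∸ 14) (≤-trans (≤-reflexive (sym (m+n∸m≡n 14 (3375 * K)))) (∸-monoˡ-≤ 14 L≥)))
  where
  14≤L : 14 ≤ L
  14≤L = ≤-trans (m≤m+n 14 (3375 * K)) L≥
  from-14 : ∀ x → 3375 * K ≤ x → K * (suc (14 + x) * (suc (14 + x) * 9 ^ (14 + x))) < 11 ^ (14 + x)
  from-14 x 3375K≤x = *-cancelˡ-< (suc L′) _ _ (begin-strict
    suc L′ * (K * (suc L′ * (suc L′ * w)))
      ≡⟨ solve 3 (λ s k w → s :* (k :* (s :* (s :* w))) := k :* (s :* (s :* s) :* w)) refl (suc L′) K w ⟩
    K * (suc L′ * (suc L′ * suc L′) * w)
      ≤⟨ *-monoʳ-≤ K (cube*9^≤3375*11^ x) ⟩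
    K * (3375 * b)
      ≡⟨ *-assoc K 3375 b ⟨
    K * 3375 * b
      <⟨ *-monoˡ-< b {{m^n≢0 11 L′}} (s≤s (subst (_≤ L′) (*-comm 3375 K) (≤-trans 3375K≤x (m≤n+m x 14)))) ⟩
    suc L′ * b ∎)
    where
    open ≤-Reasoning
    L′ = 14 + x
    w = 9 ^ L′
    b = 11 ^ L′

ℕtoℚ≡mkℚ : ∀ a → ℕtoℚ a ≡ ℚ.mkℚ (ℤ.+ a) 0 (Coprime.sym (Coprime.1-coprimeTo a))
ℕtoℚ≡mkℚ a = ℚₚ.normalize-coprime (Coprime.sym (Coprime.1-coprimeTo a))

ℕtoℚ-mono-< : ∀ {a b} → a < b → ℕtoℚ a <ℚ ℕtoℚ b
ℕtoℚ-mono-< {a} {b} a<b rewrite ℕtoℚ≡mkℚ a | ℕtoℚ≡mkℚ b =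
  ℚ.*<* (subst₂ ℤ._<_ (sym (ℤₚ.*-identityʳ (ℤ.+ a))) (sym (ℤₚ.*-identityʳ (ℤ.+ b))) (ℤ.+<+ a<b))

expPartial-1 : ∀ x → expPartial x 1 ≡ ℚ.1ℚ
expPartial-1 x = ℚₚ.+-identityʳ ℚ.1ℚ

β=o[γ]-Θ2 : (k : ℕ) → ∃ λ N → (t : ℕ) → N ≤ t → (S : List Bool) → IsSpanningTree (Θ 2 t) S →
            ∃ λ m → ℕtoℚ (suc k * βProd (Θ 2 t)) <ℚ ℕtoℚ (γ (Θ 2 t) S) *ℚ expPartial (βExp (Θ 2 t)) m
β=o[γ]-Θ2 k = 2 + (M + M) , bound
  where
  K = 225 * suc k
  M = 14 + 3375 * K
  bound : (t : ℕ) → 2 + (M + M) ≤ t → (S : List Bool) → IsSpanningTree (Θ 2 t) S →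
          ∃ λ m → ℕtoℚ (suc k * βProd (Θ 2 t)) <ℚ ℕtoℚ (γ (Θ 2 t) S) *ℚ expPartial (βExp (Θ 2 t)) m
  -- β = βProd · exp (−βExp) ≤ βProd, so it suffices to compare βProd with γ times the first partial sum, 1.
  bound (suc (suc u)) (s≤s (s≤s M+M≤u)) S tree =
    1 , subst (ℕtoℚ (suc k * βProd (Θ 2 t)) <ℚ_)
              (sym (trans (cong (ℕtoℚ (γ (Θ 2 t) S) *ℚ_) (expPartial-1 (βExp (Θ 2 t)))) (ℚₚ.*-identityʳ _)))
              (ℕtoℚ-mono-< (begin-strict
      suc k * βProd (Θ 2 t)                        ≤⟨ *-monoʳ-≤ (suc k) (βProd-Θ2-≤ t) ⟩
      suc k * (X * (X * 3 ^ (t * 1)))               ≤⟨ *-monoʳ-≤ (suc k) (*-mono-≤ X≤ (*-mono-≤ X≤ 3^≤)) ⟩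
      suc k * (5 * suc L * (5 * suc L * (9 * 9 ^ L)))
        ≡⟨ solve 3 (λ k s w → (con 1 :+ k) :* (con 5 :* s :* (con 5 :* s :* (con 9 :* w)))
                               := con 225 :* (con 1 :+ k) :* (s :* (s :* w))) refl k (suc L) (9 ^ L) ⟩
      K * (suc L * (suc L * 9 ^ L))                <⟨ quadratic*9^<11^ K L M≤L ⟩
      11 ^ L                                       ≤⟨ γ-Θ2-≥ u S tree ⟩
      γ (Θ 2 t) S                                  ∎))
    where
    open ≤-Reasoning
    t = 2 + u
    L = ⌊ suc u /2⌋
    X = suc (t * 2)
    u≤2L : u ≤ 2 * L
    u≤2L = ≤-trans (≤-pred (n≤1+⌊n/2⌋*2 (suc u))) (≤-reflexive (*-comm L 2))
    M≤L : M ≤ L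
    M≤L = ≤-trans (≤-reflexive (n≡⌊n+n/2⌋ M)) (⌊n/2⌋-mono (≤-trans M+M≤u (n≤1+n u)))
    X≤ : X ≤ 5 * suc L
    X≤ = begin
      suc ((2 + u) * 2)   ≡⟨ solve 1 (λ u → con 1 :+ (con 2 :+ u) :* con 2 := con 5 :+ con 2 :* u) refl u ⟩
      5 + 2 * u           ≤⟨ +-monoʳ-≤ 5 (*-monoʳ-≤ 2 u≤2L) ⟩
      5 + 2 * (2 * L)     ≤⟨ +-monoʳ-≤ 5 (≤-trans (≤-reflexive (sym (*-assoc 2 2 L))) (*-monoˡ-≤ L {4} {5} (n≤1+n 4))) ⟩
      5 + 5 * L           ≡⟨ *-distribˡ-+ 5 1 L ⟨
      5 * suc L           ∎
    3^≤ : 3 ^ (t * 1) ≤ 9 * 9 ^ L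
    3^≤ = begin
      3 ^ (t * 1)          ≤⟨ ^-monoʳ-≤ 3 (≤-trans (≤-reflexive (*-identityʳ t)) (+-monoʳ-≤ 2 u≤2L)) ⟩
      3 ^ (2 + 2 * L)      ≡⟨ ^-distribˡ-+-* 3 2 (2 * L) ⟩
      9 * 3 ^ (2 * L)      ≡⟨ cong (9 *_) (^-*-assoc 3 2 L) ⟨
      9 * 9 ^ L            ∎

theorem5p3 :
    ((k : ℕ) → ∃ λ N → (n : ℕ) → N ≤ n → (T : List Bool) → IsSpanningTree (Θ n 3) T →
        suc k * ∣ γ (Θ n 3) T - α (Θ n 3) ∣ ≤ α (Θ n 3))
    ×
    ((k : ℕ) → ∃ λ N → (t : ℕ) → N ≤ t → (T : List Bool) → IsSpanningTree (Θ 2 t) T →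
        ∃ λ m → ℕtoℚ (suc k * βProd (Θ 2 t)) <ℚ ℕtoℚ (γ (Θ 2 t) T) *ℚ expPartial (βExp (Θ 2 t)) m)
theorem5p3 = γ∼α-Θ3 , β=o[γ]-Θ2
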